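{- Let $w\ge2$ be even, $n$ odd with $0<n<w$, $\tilde n=w-n$, and let $m$ be a prime. Then for all $(h,k)\in\mathbb Z^+\times\mathbb Z$, $$T_mE_{w,n}(h,k)=I_{w,n}(h,mk)+\sum_{b=0}^{m-1}I_{w,n}(mh,k+bh)-\frac{1}{n+1}\Big\{\bar B_{n+1}\big(\tfrac{mk}{h}\big)+m^{\tilde n}\bar B_{n+1}\big(\tfrac kh\big)\Big\}h^w-\frac1{\tilde n+1}\Big\{\bar B_{\tilde n+1}\big(\tfrac{mk}h\big)+m^n\bar B_{\tilde n+1}\big(\tfrac kh\big)\Big\}h^w+(1+m^{w+1})\frac{w+2}{B_{w+2}}\frac{B_{n+1}}{n+1}\frac{B_{\tilde n+1}}{\tilde n+1}h^w.$$ In particular $$T_mE_{w,n}(1,0)=\sum_{b=0}^{m-1}I_{w,n}(m,b)-\frac{B_{n+1}}{n+1}(1+m^{\tilde n})-\frac{B_{\tilde n+1}}{\tilde n+1}(1+m^n)+(1+m^{w+1})\frac{w+2}{B_{w+2}}\frac{B_{n+1}}{n+1}\frac{B_{\tilde n+1}}{\tilde n+1}.$$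
   Context: $\Gamma=SL_2(\mathbb Z)$, $[x]$ integer part. $I_{w,n}(h,k)=\sum \mathrm{sgn}(k/h+b/a)(ak+bh)^{\tilde n}(ck+dh)^{n}$ over $\left(\begin{smallmatrix}a&b\\c&d\end{smallmatrix}\right)\in\Gamma/\pm1$ with $ac\ne0$ and $(k/h+b/a)(k/h+d/c)<0$ (only finitely many nonzero terms). $B_m$: Bernoulli numbers; $\bar B_m(x)=B_m(x-[x])$ with $B_m(x)$ the Bernoulli polynomial. For $n$ odd, $E_{w,n}(h,k)=I_{w,n}(h,k)-\frac{\bar B_{n+1}(k/h)}{n+1}h^w-\frac{\bar B_{\tilde n+1}(k/h)}{\tilde n+1}h^w+\frac{w+2}{B_{w+2}}\frac{B_{n+1}}{n+1}\frac{B_{\tilde n+1}}{\tilde n+1}h^w$. Hecke operator on functions $E$ on $\mathbb Z^+\times\mathbb Z$: $(T_mE)(h,k)=\sum_{ad=m,\,d>0}\sum_{b\bmod d}E(dh,ak+bh)$, so for $m$ prime $(T_mE)(h,k)=E(h,mk)+\sum_{b=0}^{m-1}E(mh,k+bh)$. -}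

module Defs where

open import Data.Nat as ℕ using (ℕ; zero; suc)
open import Data.Nat.Divisibility using (_∣?_)
open import Data.Nat.DivMod using ()
open import Data.Nat.Combinatorics using (_C_)
open import Data.Integer as ℤ using (ℤ; +_)
open import Data.Rational as ℚ using (ℚ; 0ℚ; 1ℚ; floor; _/_)
open import Data.Rational.Properties as ℚP using (_<?_; _≟_)
open import Data.List as L using (List; []; _∷_; map; upTo; filter; concatMap; allFin)
open import Data.Bool using (Bool; true; false; if_then_else_; _∧_)
open import Relation.Nullary using (yes; no; ¬_)
open import Relation.Nullary.Decidable using (does)
open import Data.Fin using (Fin; toℕ)

Σℚ : List ℚ → ℚ
Σℚ = L.foldr ℚ._+_ 0ℚ

infixr 8 _^ℚ_
_^ℚ_ : ℚ → ℕ → ℚ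
x ^ℚ zero  = 1ℚ
x ^ℚ suc e = x ℚ.* (x ^ℚ e)

ℤ→ℚ : ℤ → ℚ
ℤ→ℚ z = z / 1

ℕ→ℚ : ℕ → ℚ
ℕ→ℚ n = (+ n) / 1

-- total reciprocal (0 ↦ 0); only ever applied to nonzero arguments below
inv : ℚ → ℚ
inv q with q ≟ 0ℚ
... | yes _ = 0ℚ
... | no q≢0 = ℚ.1/_ q {{ℚ.≢-nonZero q≢0}}

sgn : ℚ → ℚ
sgn q with q <? 0ℚ
... | yes _ = ℚ.- 1ℚ
... | no _ with 0ℚ <? q
...   | yes _ = 1ℚ
...   | no _ = 0ℚ

symRange : ℕ → List ℤ
symRange B = map (λ i → (+ i) ℤ.- (+ B)) (upTo (suc (B ℕ.+ B)))

posRange : ℕ → List ℤ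
posRange B = map (λ i → + suc i) (upTo B)

-- Bernoulli numbers (convention B₁ = -1/2), via
--   B₀ = 1,   Σ_{j=0}^{m} C(m+1,j) B_j = 0  (m ≥ 1),
-- i.e.  B_m = -(1/(m+1)) Σ_{j<m} C(m+1,j) B_j.
-- (Only even-index values enter the statement, so the B₁ convention is immaterial.)

private
  step : ℕ → List ℚ → ℚ
  step m bs = ℚ.- (inv (ℕ→ℚ (suc m)) ℚ.*
                Σℚ (L.zipWith (λ j b → ℕ→ℚ (suc m C j) ℚ.* b) (upTo m) bs))

bernUpTo : ℕ → List ℚ
bernUpTo zero    = 1ℚ ∷ []
bernUpTo (suc m) = let bs = bernUpTo m in bs L.++ (step (suc m) bs ∷ [])

bernoulli : ℕ → ℚ
bernoulli m = L.foldr (λ x _ → x) 0ℚ (L.reverse (bernUpTo m))   -- last element = B_m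

bernPoly : ℕ → ℚ → ℚ
bernPoly m x = Σℚ (map (λ j → ℕ→ℚ (m C j) ℚ.* bernoulli j ℚ.* (x ^ℚ (m ℕ.∸ j)))
                       (upTo (suc m)))

bernBar : ℕ → ℚ → ℚ
bernBar m x = bernPoly m (x ℚ.- ℤ→ℚ (floor x))

-- Γ/±1 is represented by the matrices (a b; c d) ∈ SL₂(ℤ) with a > 0
-- (a ≠ 0 is required in the sum, and the summand is invariant under
-- M ↦ -M since w = n + ñ is even).  Every matrix contributing to the sum
-- satisfies a ≤ h, |c| ≤ h, |b|,|d| ≤ |k|+1, so it suffices
-- to sum over the box with all entries bounded by  B = h + |k| + 1 ;
-- the defining conditions are imposed exactly.

record Mat : Set where
  constructor mat
  field a b c d : ℤ

isSL2 : Mat → Bool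
isSL2 (mat a b c d) = does ((a ℤ.* d ℤ.- b ℤ.* c) ℤ.≟ + 1)

condI : ℕ → ℤ → Mat → Bool
condI h k (mat a b c d) with a ℤ.≟ + 0 | c ℤ.≟ + 0
... | yes _ | _ = false
... | no _ | yes _ = false
... | no a≢0 | no c≢0 =
  does (((ℤ→ℚ k ℚ.* inv (ℕ→ℚ h) ℚ.+ ℤ→ℚ b ℚ.* inv (ℤ→ℚ a))
      ℚ.* (ℤ→ℚ k ℚ.* inv (ℕ→ℚ h) ℚ.+ ℤ→ℚ d ℚ.* inv (ℤ→ℚ c))) <? 0ℚ)

box : ℕ → List Mat
box B = concatMap (λ a → concatMap (λ b → concatMap (λ c → map (λ d → mat a b c d)
          (symRange B)) (symRange B)) (symRange B)) (posRange B)

indexI : ℕ → ℤ → List Mat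
indexI h k = L.filterᵇ (λ M → isSL2 M ∧ condI h k M)
                       (box (h ℕ.+ ℤ.∣ k ∣ ℕ.+ 1))

tilde : ℕ → ℕ → ℕ
tilde w n = w ℕ.∸ n

termI : ℕ → ℕ → ℕ → ℤ → Mat → ℚ
termI w n h k (mat a b c d) =
  sgn (ℤ→ℚ k ℚ.* inv (ℕ→ℚ h) ℚ.+ ℤ→ℚ b ℚ.* inv (ℤ→ℚ a))
  ℚ.* (ℤ→ℚ (a ℤ.* k ℤ.+ b ℤ.* + h) ^ℚ tilde w n)
  ℚ.* (ℤ→ℚ (c ℤ.* k ℤ.+ d ℤ.* + h) ^ℚ n)

I : ℕ → ℕ → ℕ → ℤ → ℚ
I w n h k = Σℚ (map (termI w n h k) (indexI h k))

C : ℕ → ℕ → ℚ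
C w n = ℕ→ℚ (w ℕ.+ 2) ℚ.* inv (bernoulli (w ℕ.+ 2))
        ℚ.* (inv (ℕ→ℚ (n ℕ.+ 1)) ℚ.* bernoulli (n ℕ.+ 1))
        ℚ.* (inv (ℕ→ℚ (tilde w n ℕ.+ 1)) ℚ.* bernoulli (tilde w n ℕ.+ 1))

E : ℕ → ℕ → ℕ → ℤ → ℚ
E w n h k =
  I w n h k
  ℚ.- inv (ℕ→ℚ (n ℕ.+ 1)) ℚ.* bernBar (n ℕ.+ 1) q ℚ.* hw
  ℚ.- inv (ℕ→ℚ (tilde w n ℕ.+ 1)) ℚ.* bernBar (tilde w n ℕ.+ 1) q ℚ.* hw
  ℚ.+ C w n ℚ.* hw
  where
  q  = ℤ→ℚ k ℚ.* inv (ℕ→ℚ h)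
  hw = ℕ→ℚ h ^ℚ w

-- Hecke operator on functions  E : ℤ⁺ × ℤ → ℚ  (h ∈ ℕ, h ≥ 1):
--   (T_m E)(h,k) = Σ_{ad=m, d>0} Σ_{b mod d} E(dh, ak+bh)
-- d = suc i runs over the positive divisors of m (i < m), a = m/d, b = 0,…,d-1.

T : (m : ℕ) → (ℕ → ℤ → ℚ) → ℕ → ℤ → ℚ
T m F h k =
  Σℚ (map (λ i → Σℚ (map (λ b → F (suc i ℕ.* h) (+ (m ℕ./ suc i) ℤ.* k ℤ.+ + b ℤ.* + h))
                           (upTo (suc i))))
          (filter (λ i → suc i ∣? m) (upTo m)))

-- For prime m only the divisors 1 and m enter T_m, so T_m E(h,k) = E(h,mk) + Σ_{b<m} E(mh,k+bh).
-- The I-terms are carried along, the constant terms add up to (1 + m^(w+1)) C h^w because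
-- (mh)^w = m^w h^w, and the Bernoulli terms collapse by the distribution relation
-- m^(N-1) Σ_{b<m} B̄_N((x+b)/m) = B̄_N(x) at x = k/h, for N = n+1 and N = ñ+1.
-- Its left side is 1-periodic in x, which reduces it to x ∈ [0,1), i.e. to Raabe's formula
-- m^(N-1) Σ_{b<m} B_N((x+b)/m) = B_N(x). Both sides of Raabe's formula are Appell polynomials
-- Σ_i C(N,i) a_i x^(N-i); the difference d of their coefficient sequences satisfies
-- Σ_i C(N,i) d_i = d_N for every N (as B_N(1) = B_N for N ≠ 1), and this recursion forces d = 0.
-- The special value at (1,0) then uses I(1,0) = 0 and B̄_N(0) = B_N.

module Submission where

open import Defs
open import Data.Nat using (ℕ; _<_; _+_; _*_; _≤_)
open import Data.Nat.Primality using (Prime)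
open import Data.Nat.Divisibility using (_∣_)
open import Relation.Nullary using (¬_)
open import Data.Integer as ℤ using (ℤ; +_)
open import Data.Rational as ℚ using (ℚ)
open import Data.List using (map; upTo)
open import Data.Product using (_×_)
open import Relation.Binary.PropositionalEquality using (_≡_)

open import Data.Bool using (true; false; if_then_else_)
open import Data.Empty using (⊥-elim)
open import Data.Integer.DivMod as ℤ÷ using ()
import Data.Integer.Properties as ℤP
open import Data.List as List using ([]; _∷_)
import Data.List.Properties as ListP
open import Data.Nat as ℕ using (zero; suc)
open import Data.Nat.Combinatorics using (nCk+nC[k+1]≡[n+1]C[k+1]; k>n⇒nCk≡0; nCn≡1; nC1≡n; nCk≡nC[n∸k])
  renaming (_C_ to _choose_)
open import Data.Nat.Coprimality as Coprime using (1-coprimeTo)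
open import Data.Nat.Divisibility using (_∣?_; 1∣_; ∣-refl)
open import Data.Nat.DivMod as ℕ÷ using ()
open import Data.Nat.Induction using (<-rec)
open import Data.Nat.Primality using (prime⇒¬composite; composite; ¬prime[0]; ¬prime[1])
import Data.Nat.Properties as ℕP
open import Data.Product using (_,_; proj₁; proj₂)
open import Data.Rational using (0ℚ; 1ℚ)
import Data.Rational.Properties as ℚP
open import Data.Rational.Solver using (module +-*-Solver)
open import Relation.Binary.PropositionalEquality using (refl; sym; trans; cong; cong₂; subst; subst₂; module ≡-Reasoning)
open import Relation.Nullary using (Dec; does; yes; no)
open import Relation.Nullary.Decidable using (dec-true; dec-false)

open ≡-Reasoning
open +-*-Solver

-- ℕ's _+_ and _*_ are in scope unqualified, so ℚ's operations get suffixed names.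
infixl 6 _+ℚ_ _-ℚ_
infixl 7 _*ℚ_

_+ℚ_ _-ℚ_ _*ℚ_ : ℚ → ℚ → ℚ
_+ℚ_ = ℚ._+_
_-ℚ_ = ℚ._-_
_*ℚ_ = ℚ._*_

-- ℤ→ℚ z = z / 1 normalises through a gcd; on this normal form ℚ's operations compute.
ℤ→ℚ≡mkℚ : ∀ z → ℤ→ℚ z ≡ ℚ.mkℚ z 0 (Coprime.sym (1-coprimeTo ℤ.∣ z ∣))
ℤ→ℚ≡mkℚ z = ℚP.fromℚᵘ-toℚᵘ _

ℤ→ℚ-homo-+ : ∀ a b → ℤ→ℚ (a ℤ.+ b) ≡ ℤ→ℚ a +ℚ ℤ→ℚ b
ℤ→ℚ-homo-+ a b = begin
  ℤ→ℚ (a ℤ.+ b)                       ≡⟨ cong₂ (λ u v → (u ℤ.+ v) ℚ./ 1) (sym (ℤP.*-identityʳ a)) (sym (ℤP.*-identityʳ b)) ⟩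
  (a ℤ.* + 1 ℤ.+ b ℤ.* + 1) ℚ./ 1     ≡⟨ cong₂ _+ℚ_ (ℤ→ℚ≡mkℚ a) (ℤ→ℚ≡mkℚ b) ⟨
  ℤ→ℚ a +ℚ ℤ→ℚ b                      ∎

ℤ→ℚ-homo-* : ∀ a b → ℤ→ℚ (a ℤ.* b) ≡ ℤ→ℚ a *ℚ ℤ→ℚ b
ℤ→ℚ-homo-* a b = sym (cong₂ _*ℚ_ (ℤ→ℚ≡mkℚ a) (ℤ→ℚ≡mkℚ b))

ℕ→ℚ-homo-+ : ∀ a b → ℕ→ℚ (a + b) ≡ ℕ→ℚ a +ℚ ℕ→ℚ b
ℕ→ℚ-homo-+ a b = ℤ→ℚ-homo-+ (+ a) (+ b)

ℕ→ℚ-homo-* : ∀ a b → ℕ→ℚ (a * b) ≡ ℕ→ℚ a *ℚ ℕ→ℚ b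
ℕ→ℚ-homo-* a b = trans (cong ℤ→ℚ (ℤP.pos-* a b)) (ℤ→ℚ-homo-* (+ a) (+ b))

ℕ→ℚ-suc : ∀ k → ℕ→ℚ (suc k) ≡ 1ℚ +ℚ ℕ→ℚ k
ℕ→ℚ-suc = ℕ→ℚ-homo-+ 1

ℤ→ℚ-suc : ∀ z → ℤ→ℚ (ℤ.suc z) ≡ 1ℚ +ℚ ℤ→ℚ z
ℤ→ℚ-suc = ℤ→ℚ-homo-+ (+ 1)

ℕ→ℚ-suc≢0 : ∀ k → ¬ (ℕ→ℚ (suc k) ≡ 0ℚ)
ℕ→ℚ-suc≢0 k eq with trans (sym (ℤ→ℚ≡mkℚ (+ suc k))) eq
... | ()

ℤ→ℚ-mono-≤ : ∀ {a b} → a ℤ.≤ b → ℤ→ℚ a ℚ.≤ ℤ→ℚ b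
ℤ→ℚ-mono-≤ {a} {b} a≤b = subst₂ ℚ._≤_ (sym (ℤ→ℚ≡mkℚ a)) (sym (ℤ→ℚ≡mkℚ b))
  (ℚ.*≤* (subst₂ ℤ._≤_ (sym (ℤP.*-identityʳ a)) (sym (ℤP.*-identityʳ b)) a≤b))

ℤ→ℚ-cancel-< : ∀ {a b} → ℤ→ℚ a ℚ.< ℤ→ℚ b → a ℤ.< b
ℤ→ℚ-cancel-< {a} {b} lt with subst₂ ℚ._<_ (ℤ→ℚ≡mkℚ a) (ℤ→ℚ≡mkℚ b) lt
... | ℚ.*<* l = subst₂ ℤ._<_ (ℤP.*-identityʳ a) (ℤP.*-identityʳ b) l

inv-inverseʳ : ∀ q → ¬ (q ≡ 0ℚ) → q *ℚ inv q ≡ 1ℚ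
inv-inverseʳ q q≢0 with q ℚP.≟ 0ℚ
... | yes q≡0 = ⊥-elim (q≢0 q≡0)
... | no q≢0′ = ℚP.*-inverseʳ q {{ℚ.≢-nonZero q≢0′}}

inv-cancelˡ : ∀ s a → ¬ (s ≡ 0ℚ) → inv s *ℚ (s *ℚ a) ≡ a
inv-cancelˡ s a s≢0 = begin
  inv s *ℚ (s *ℚ a)  ≡⟨ solve 3 (λ s i a → i :* (s :* a) := s :* i :* a) refl s (inv s) a ⟩
  s *ℚ inv s *ℚ a    ≡⟨ cong (_*ℚ a) (inv-inverseʳ s s≢0) ⟩
  1ℚ *ℚ a            ≡⟨ ℚP.*-identityˡ a ⟩
  a                  ∎

*-cancelˡ : ∀ s {a b} → ¬ (s ≡ 0ℚ) → s *ℚ a ≡ s *ℚ b → a ≡ b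
*-cancelˡ s {a} {b} s≢0 eq = begin
  a                  ≡⟨ inv-cancelˡ s a s≢0 ⟨
  inv s *ℚ (s *ℚ a)  ≡⟨ cong (inv s *ℚ_) eq ⟩
  inv s *ℚ (s *ℚ b)  ≡⟨ inv-cancelˡ s b s≢0 ⟩
  b                  ∎

inv-unique : ∀ a {u} → ¬ (a ≡ 0ℚ) → a *ℚ u ≡ 1ℚ → inv a ≡ u
inv-unique a a≢0 au≡1 = *-cancelˡ a a≢0 (trans (inv-inverseʳ a a≢0) (sym au≡1))

inv-ℕ→ℚ-* : ∀ a b → inv (ℕ→ℚ (suc a * suc b)) ≡ inv (ℕ→ℚ (suc a)) *ℚ inv (ℕ→ℚ (suc b))
inv-ℕ→ℚ-* a b = inv-unique (ℕ→ℚ (suc a * suc b)) (ℕ→ℚ-suc≢0 (b + a * suc b)) (begin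
  ℕ→ℚ (suc a * suc b) *ℚ (inv A *ℚ inv B)  ≡⟨ cong (_*ℚ (inv A *ℚ inv B)) (ℕ→ℚ-homo-* (suc a) (suc b)) ⟩
  A *ℚ B *ℚ (inv A *ℚ inv B)               ≡⟨ solve 4 (λ A B i j → A :* B :* (i :* j) := (A :* i) :* (B :* j)) refl A B (inv A) (inv B) ⟩
  (A *ℚ inv A) *ℚ (B *ℚ inv B)             ≡⟨ cong₂ _*ℚ_ (inv-inverseʳ A (ℕ→ℚ-suc≢0 a)) (inv-inverseʳ B (ℕ→ℚ-suc≢0 b)) ⟩
  1ℚ                                       ∎)
  where
  A = ℕ→ℚ (suc a)
  B = ℕ→ℚ (suc b)

^ℚ-distribʳ-* : ∀ a b e → (a *ℚ b) ^ℚ e ≡ a ^ℚ e *ℚ b ^ℚ e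
^ℚ-distribʳ-* a b zero    = refl
^ℚ-distribʳ-* a b (suc e) = begin
  a *ℚ b *ℚ (a *ℚ b) ^ℚ e       ≡⟨ cong (a *ℚ b *ℚ_) (^ℚ-distribʳ-* a b e) ⟩
  a *ℚ b *ℚ (a ^ℚ e *ℚ b ^ℚ e)  ≡⟨ solve 4 (λ a b x y → a :* b :* (x :* y) := a :* x :* (b :* y)) refl a b (a ^ℚ e) (b ^ℚ e) ⟩
  a ^ℚ suc e *ℚ b ^ℚ suc e      ∎

^ℚ-distribˡ-+-* : ∀ a u v → a ^ℚ (u + v) ≡ a ^ℚ u *ℚ a ^ℚ v
^ℚ-distribˡ-+-* a zero    v = sym (ℚP.*-identityˡ _)
^ℚ-distribˡ-+-* a (suc u) v = trans (cong (a *ℚ_) (^ℚ-distribˡ-+-* a u v)) (sym (ℚP.*-assoc a (a ^ℚ u) (a ^ℚ v)))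

1^ℚ≡1 : ∀ e → 1ℚ ^ℚ e ≡ 1ℚ
1^ℚ≡1 zero    = refl
1^ℚ≡1 (suc e) = trans (ℚP.*-identityˡ _) (1^ℚ≡1 e)

-- Finite sums

Σℚ-++ : ∀ xs ys → Σℚ (xs List.++ ys) ≡ Σℚ xs +ℚ Σℚ ys
Σℚ-++ []       ys = sym (ℚP.+-identityˡ _)
Σℚ-++ (x ∷ xs) ys = trans (cong (x +ℚ_) (Σℚ-++ xs ys)) (sym (ℚP.+-assoc x _ _))

module _ {A : Set} where

  Σℚ-map-+ : ∀ (f g : A → ℚ) xs → Σℚ (map (λ x → f x +ℚ g x) xs) ≡ Σℚ (map f xs) +ℚ Σℚ (map g xs)
  Σℚ-map-+ f g []       = refl
  Σℚ-map-+ f g (x ∷ xs) = trans (cong (f x +ℚ g x +ℚ_) (Σℚ-map-+ f g xs))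
    (solve 4 (λ a b c d → a :+ b :+ (c :+ d) := a :+ c :+ (b :+ d)) refl (f x) (g x) (Σℚ (map f xs)) (Σℚ (map g xs)))

  Σℚ-map-*ˡ : ∀ c (f : A → ℚ) xs → Σℚ (map (λ x → c *ℚ f x) xs) ≡ c *ℚ Σℚ (map f xs)
  Σℚ-map-*ˡ c f []       = sym (ℚP.*-zeroʳ c)
  Σℚ-map-*ˡ c f (x ∷ xs) = trans (cong (c *ℚ f x +ℚ_) (Σℚ-map-*ˡ c f xs)) (sym (ℚP.*-distribˡ-+ c (f x) _))

Σ< : ℕ → (ℕ → ℚ) → ℚ
Σ< n f = Σℚ (map f (upTo n))

Σ<-+ : ∀ n f g → Σ< n (λ i → f i +ℚ g i) ≡ Σ< n f +ℚ Σ< n g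
Σ<-+ n f g = Σℚ-map-+ f g (upTo n)

Σ<-*ˡ : ∀ n c f → Σ< n (λ i → c *ℚ f i) ≡ c *ℚ Σ< n f
Σ<-*ˡ n c f = Σℚ-map-*ˡ c f (upTo n)

Σ<-suc : ∀ n f → Σ< (suc n) f ≡ Σ< n f +ℚ f n
Σ<-suc n f = begin
  Σℚ (map f (upTo (suc n)))               ≡⟨ cong (λ l → Σℚ (map f l)) (ListP.upTo-∷ʳ n) ⟨
  Σℚ (map f (upTo n List.++ n ∷ []))      ≡⟨ cong Σℚ (ListP.map-++ f (upTo n) (n ∷ [])) ⟩
  Σℚ (map f (upTo n) List.++ f n ∷ [])    ≡⟨ Σℚ-++ (map f (upTo n)) (f n ∷ []) ⟩
  Σ< n f +ℚ (f n +ℚ 0ℚ)                   ≡⟨ cong (Σ< n f +ℚ_) (ℚP.+-identityʳ (f n)) ⟩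
  Σ< n f +ℚ f n                           ∎

Σ<-sucˡ : ∀ n f → Σ< (suc n) f ≡ f 0 +ℚ Σ< n (λ i → f (suc i))
Σ<-sucˡ n f = cong (λ l → f 0 +ℚ Σℚ l)
  (trans (ListP.map-applyUpTo suc f n) (sym (ListP.map-upTo (λ i → f (suc i)) n)))

Σ<-cong : ∀ n {f g} → (∀ i → i < n → f i ≡ g i) → Σ< n f ≡ Σ< n g
Σ<-cong zero    eq = refl
Σ<-cong (suc n) {f} {g} eq = begin
  Σ< (suc n) f   ≡⟨ Σ<-suc n f ⟩
  Σ< n f +ℚ f n  ≡⟨ cong₂ _+ℚ_ (Σ<-cong n (λ i i<n → eq i (ℕP.m<n⇒m<1+n i<n))) (eq n ℕP.≤-refl) ⟩
  Σ< n g +ℚ g n  ≡⟨ Σ<-suc n g ⟨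
  Σ< (suc n) g   ∎

Σ<-zero : ∀ n → Σ< n (λ _ → 0ℚ) ≡ 0ℚ
Σ<-zero n = trans (Σ<-*ˡ n 0ℚ (λ _ → 0ℚ)) (ℚP.*-zeroˡ (Σ< n (λ _ → 0ℚ)))

Σ<-telescope : ∀ n f → Σ< n (λ i → f (suc i)) ≡ Σ< n f +ℚ f n -ℚ f 0
Σ<-telescope n f = begin
  S                          ≡⟨ solve 2 (λ S a → S := a :+ S :- a) refl S (f 0) ⟩
  f 0 +ℚ S -ℚ f 0            ≡⟨ cong (_-ℚ f 0) (Σ<-sucˡ n f) ⟨
  Σ< (suc n) f -ℚ f 0        ≡⟨ cong (_-ℚ f 0) (Σ<-suc n f) ⟩
  Σ< n f +ℚ f n -ℚ f 0       ∎
  where S = Σ< n (λ i → f (suc i))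

Σ<-linear : ∀ n (A X Y : ℕ → ℚ) a b c K →
  Σ< n (λ i → A i -ℚ a *ℚ X i *ℚ K -ℚ b *ℚ Y i *ℚ K +ℚ c *ℚ K)
    ≡ Σ< n A -ℚ a *ℚ Σ< n X *ℚ K -ℚ b *ℚ Σ< n Y *ℚ K +ℚ ℕ→ℚ n *ℚ c *ℚ K
Σ<-linear zero    A X Y a b c K = solve 4 (λ a b c K → con 0ℚ := con 0ℚ :- a :* con 0ℚ :* K :- b :* con 0ℚ :* K :+ con 0ℚ :* c :* K) refl a b c K
Σ<-linear (suc n) A X Y a b c K = begin
  Σ< (suc n) (λ i → A i -ℚ a *ℚ X i *ℚ K -ℚ b *ℚ Y i *ℚ K +ℚ c *ℚ K)
    ≡⟨ Σ<-suc n (λ i → A i -ℚ a *ℚ X i *ℚ K -ℚ b *ℚ Y i *ℚ K +ℚ c *ℚ K) ⟩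
  Σ< n (λ i → A i -ℚ a *ℚ X i *ℚ K -ℚ b *ℚ Y i *ℚ K +ℚ c *ℚ K) +ℚ (A n -ℚ a *ℚ X n *ℚ K -ℚ b *ℚ Y n *ℚ K +ℚ c *ℚ K)
    ≡⟨ cong (_+ℚ (A n -ℚ a *ℚ X n *ℚ K -ℚ b *ℚ Y n *ℚ K +ℚ c *ℚ K)) (Σ<-linear n A X Y a b c K) ⟩
  ΣA -ℚ a *ℚ ΣX *ℚ K -ℚ b *ℚ ΣY *ℚ K +ℚ ℕ→ℚ n *ℚ c *ℚ K +ℚ (A n -ℚ a *ℚ X n *ℚ K -ℚ b *ℚ Y n *ℚ K +ℚ c *ℚ K)
    ≡⟨ solve 11 (λ SA SX SY An Xn Yn a b c K N →
         SA :- a :* SX :* K :- b :* SY :* K :+ N :* c :* K :+ (An :- a :* Xn :* K :- b :* Yn :* K :+ c :* K)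
         := (SA :+ An) :- a :* (SX :+ Xn) :* K :- b :* (SY :+ Yn) :* K :+ (con 1ℚ :+ N) :* c :* K)
         refl ΣA ΣX ΣY (A n) (X n) (Y n) a b c K (ℕ→ℚ n) ⟩
  (ΣA +ℚ A n) -ℚ a *ℚ (ΣX +ℚ X n) *ℚ K -ℚ b *ℚ (ΣY +ℚ Y n) *ℚ K +ℚ (1ℚ +ℚ ℕ→ℚ n) *ℚ c *ℚ K
    ≡⟨ cong₂ (λ u v → u -ℚ a *ℚ (ΣX +ℚ X n) *ℚ K -ℚ b *ℚ (ΣY +ℚ Y n) *ℚ K +ℚ v *ℚ c *ℚ K) (sym (Σ<-suc n A)) (sym (ℕ→ℚ-suc n)) ⟩
  Σ< (suc n) A -ℚ a *ℚ (ΣX +ℚ X n) *ℚ K -ℚ b *ℚ (ΣY +ℚ Y n) *ℚ K +ℚ ℕ→ℚ (suc n) *ℚ c *ℚ K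
    ≡⟨ cong₂ (λ u v → Σ< (suc n) A -ℚ a *ℚ u *ℚ K -ℚ b *ℚ v *ℚ K +ℚ ℕ→ℚ (suc n) *ℚ c *ℚ K) (sym (Σ<-suc n X)) (sym (Σ<-suc n Y)) ⟩
  Σ< (suc n) A -ℚ a *ℚ Σ< (suc n) X *ℚ K -ℚ b *ℚ Σ< (suc n) Y *ℚ K +ℚ ℕ→ℚ (suc n) *ℚ c *ℚ K
    ∎
  where
  ΣA = Σ< n A
  ΣX = Σ< n X
  ΣY = Σ< n Y

Σℚ-filter : ∀ {A : Set} {P : A → Set} (P? : ∀ x → Dec (P x)) (G : A → ℚ) xs →
  Σℚ (map G (List.filter P? xs)) ≡ Σℚ (map (λ x → if does (P? x) then G x else 0ℚ) xs)
Σℚ-filter P? G []       = refl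
Σℚ-filter P? G (x ∷ xs) with does (P? x)
... | true  = cong (G x +ℚ_) (Σℚ-filter P? G xs)
... | false = trans (Σℚ-filter P? G xs) (sym (ℚP.+-identityˡ _))

-- Appell polynomials

-- bernPoly N unfolds to appell N bernoulli, so everything below applies to it directly.
appell : ℕ → (ℕ → ℚ) → ℚ → ℚ
appell N a x = Σ< (suc N) (λ i → ℕ→ℚ (N choose i) *ℚ a i *ℚ x ^ℚ (N ℕ.∸ i))

appell-cong : ∀ N {a b} x → (∀ i → a i ≡ b i) → appell N a x ≡ appell N b x
appell-cong N x a≗b = Σ<-cong (suc N) (λ i _ → cong (λ c → ℕ→ℚ (N choose i) *ℚ c *ℚ x ^ℚ (N ℕ.∸ i)) (a≗b i))

appell-+ : ∀ N a b x → appell N (λ i → a i +ℚ b i) x ≡ appell N a x +ℚ appell N b x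
appell-+ N a b x = trans
  (Σ<-cong (suc N) (λ i _ → solve 4 (λ c p q r → c :* (p :+ q) :* r := c :* p :* r :+ c :* q :* r) refl
    (ℕ→ℚ (N choose i)) (a i) (b i) (x ^ℚ (N ℕ.∸ i))))
  (Σ<-+ (suc N) (λ i → ℕ→ℚ (N choose i) *ℚ a i *ℚ x ^ℚ (N ℕ.∸ i)) (λ i → ℕ→ℚ (N choose i) *ℚ b i *ℚ x ^ℚ (N ℕ.∸ i)))

appell-*ˡ : ∀ N c a x → appell N (λ i → c *ℚ a i) x ≡ c *ℚ appell N a x
appell-*ˡ N c a x = trans
  (Σ<-cong (suc N) (λ i _ → solve 4 (λ d c p r → d :* (c :* p) :* r := c :* (d :* p :* r)) refl
    (ℕ→ℚ (N choose i)) c (a i) (x ^ℚ (N ℕ.∸ i))))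
  (Σ<-*ˡ (suc N) c (λ i → ℕ→ℚ (N choose i) *ℚ a i *ℚ x ^ℚ (N ℕ.∸ i)))

Σ<-appell : ∀ M N (a : ℕ → ℕ → ℚ) x → Σ< M (λ c → appell N (a c) x) ≡ appell N (λ i → Σ< M (λ c → a c i)) x
Σ<-appell zero N a x = begin
  0ℚ                          ≡⟨ ℚP.*-zeroˡ (appell N (λ _ → 0ℚ) x) ⟨
  0ℚ *ℚ appell N (λ _ → 0ℚ) x ≡⟨ appell-*ˡ N 0ℚ (λ _ → 0ℚ) x ⟨
  appell N (λ _ → 0ℚ *ℚ 0ℚ) x ∎
Σ<-appell (suc M) N a x = begin
  Σ< (suc M) (λ c → appell N (a c) x)                  ≡⟨ Σ<-suc M (λ c → appell N (a c) x) ⟩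
  Σ< M (λ c → appell N (a c) x) +ℚ appell N (a M) x    ≡⟨ cong (_+ℚ appell N (a M) x) (Σ<-appell M N a x) ⟩
  appell N Σa x +ℚ appell N (a M) x                    ≡⟨ appell-+ N Σa (a M) x ⟨
  appell N (λ i → Σa i +ℚ a M i) x                     ≡⟨ appell-cong N x (λ i → Σ<-suc M (λ c → a c i)) ⟨
  appell N (λ i → Σ< (suc M) (λ c → a c i)) x          ∎
  where Σa = λ i → Σ< M (λ c → a c i)

appell-0 : ∀ a x → appell 0 a x ≡ a 0
appell-0 a x = solve 1 (λ a → con 1ℚ :* a :* con 1ℚ :+ con 0ℚ := a) refl (a 0)

shifted-binomial-sum : ∀ N (b : ℕ → ℚ) x →
  Σ< (suc N) (λ i → ℕ→ℚ (N choose suc i) *ℚ b i *ℚ x ^ℚ (N ℕ.∸ i))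
    ≡ x *ℚ Σ< N (λ i → ℕ→ℚ (N choose suc i) *ℚ b i *ℚ x ^ℚ (N ℕ.∸ suc i))
shifted-binomial-sum N b x = begin
  Σ< (suc N) upper                    ≡⟨ Σ<-suc N upper ⟩
  Σ< N upper +ℚ upper N               ≡⟨ cong₂ _+ℚ_ (Σ<-cong N upper≡x*lower) upper[N]≡0 ⟩
  Σ< N (λ i → x *ℚ lower i) +ℚ 0ℚ     ≡⟨ ℚP.+-identityʳ _ ⟩
  Σ< N (λ i → x *ℚ lower i)           ≡⟨ Σ<-*ˡ N x lower ⟩
  x *ℚ Σ< N lower                     ∎
  where
  upper lower : ℕ → ℚ
  upper i = ℕ→ℚ (N choose suc i) *ℚ b i *ℚ x ^ℚ (N ℕ.∸ i)
  lower i = ℕ→ℚ (N choose suc i) *ℚ b i *ℚ x ^ℚ (N ℕ.∸ suc i)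
  upper≡x*lower : ∀ i → i < N → upper i ≡ x *ℚ lower i
  upper≡x*lower i i<N = trans
    (cong (λ e → ℕ→ℚ (N choose suc i) *ℚ b i *ℚ x ^ℚ e) (ℕP.+-∸-assoc 1 i<N))
    (solve 4 (λ c b x p → c :* b :* (x :* p) := x :* (c :* b :* p)) refl (ℕ→ℚ (N choose suc i)) (b i) x (x ^ℚ (N ℕ.∸ suc i)))
  upper[N]≡0 : upper N ≡ 0ℚ
  upper[N]≡0 = trans (cong (λ c → ℕ→ℚ c *ℚ b N *ℚ x ^ℚ (N ℕ.∸ N)) (k>n⇒nCk≡0 (ℕP.n<1+n N)))
    (solve 2 (λ b p → con 0ℚ :* b :* p := con 0ℚ) refl (b N) (x ^ℚ (N ℕ.∸ N)))

appell-suc : ∀ N a x → appell (suc N) a x ≡ x *ℚ appell N a x +ℚ appell N (λ i → a (suc i)) x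
appell-suc N a x = begin
  appell (suc N) a x
    ≡⟨ Σ<-sucˡ (suc N) (λ i → ℕ→ℚ (suc N choose i) *ℚ a i *ℚ x ^ℚ (suc N ℕ.∸ i)) ⟩
  a₀ +ℚ Σ< (suc N) (λ i → ℕ→ℚ (suc N choose suc i) *ℚ a (suc i) *ℚ x ^ℚ (N ℕ.∸ i))
    ≡⟨ cong (a₀ +ℚ_) (Σ<-cong (suc N) (λ i _ → pascal i)) ⟩
  a₀ +ℚ Σ< (suc N) (λ i → ℕ→ℚ (N choose i) *ℚ a (suc i) *ℚ x ^ℚ (N ℕ.∸ i) +ℚ upper i)
    ≡⟨ cong (a₀ +ℚ_) (Σ<-+ (suc N) (λ i → ℕ→ℚ (N choose i) *ℚ a (suc i) *ℚ x ^ℚ (N ℕ.∸ i)) upper) ⟩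
  a₀ +ℚ (appell N (λ i → a (suc i)) x +ℚ Σ< (suc N) upper)
    ≡⟨ cong (λ u → a₀ +ℚ (appell N (λ i → a (suc i)) x +ℚ u)) (shifted-binomial-sum N (λ i → a (suc i)) x) ⟩
  a₀ +ℚ (appell N (λ i → a (suc i)) x +ℚ x *ℚ Σ< N lower)
    ≡⟨ solve 5 (λ x a0 xN s S → con 1ℚ :* a0 :* (x :* xN) :+ (s :+ x :* S) := x :* (con 1ℚ :* a0 :* xN :+ S) :+ s)
         refl x (a 0) (x ^ℚ N) (appell N (λ i → a (suc i)) x) (Σ< N lower) ⟩
  x *ℚ (ℕ→ℚ (N choose 0) *ℚ a 0 *ℚ x ^ℚ N +ℚ Σ< N lower) +ℚ appell N (λ i → a (suc i)) x
    ≡⟨ cong (λ u → x *ℚ u +ℚ appell N (λ i → a (suc i)) x) (Σ<-sucˡ N (λ i → ℕ→ℚ (N choose i) *ℚ a i *ℚ x ^ℚ (N ℕ.∸ i))) ⟨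
  x *ℚ appell N a x +ℚ appell N (λ i → a (suc i)) x
    ∎
  where
  a₀ = ℕ→ℚ (suc N choose 0) *ℚ a 0 *ℚ x ^ℚ suc N
  upper lower : ℕ → ℚ
  upper i = ℕ→ℚ (N choose suc i) *ℚ a (suc i) *ℚ x ^ℚ (N ℕ.∸ i)
  lower i = ℕ→ℚ (N choose suc i) *ℚ a (suc i) *ℚ x ^ℚ (N ℕ.∸ suc i)

  pascal : ∀ i → ℕ→ℚ (suc N choose suc i) *ℚ a (suc i) *ℚ x ^ℚ (N ℕ.∸ i)
                 ≡ ℕ→ℚ (N choose i) *ℚ a (suc i) *ℚ x ^ℚ (N ℕ.∸ i) +ℚ upper i
  pascal i = begin
    ℕ→ℚ (suc N choose suc i) *ℚ a (suc i) *ℚ x ^ℚ (N ℕ.∸ i)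
      ≡⟨ cong (λ c → ℕ→ℚ c *ℚ a (suc i) *ℚ x ^ℚ (N ℕ.∸ i)) (nCk+nC[k+1]≡[n+1]C[k+1] N i) ⟨
    ℕ→ℚ (N choose i + N choose suc i) *ℚ a (suc i) *ℚ x ^ℚ (N ℕ.∸ i)
      ≡⟨ cong (λ c → c *ℚ a (suc i) *ℚ x ^ℚ (N ℕ.∸ i)) (ℕ→ℚ-homo-+ (N choose i) (N choose suc i)) ⟩
    (ℕ→ℚ (N choose i) +ℚ ℕ→ℚ (N choose suc i)) *ℚ a (suc i) *ℚ x ^ℚ (N ℕ.∸ i)
      ≡⟨ solve 4 (λ p q r s → (p :+ q) :* r :* s := p :* r :* s :+ q :* r :* s) refl
           (ℕ→ℚ (N choose i)) (ℕ→ℚ (N choose suc i)) (a (suc i)) (x ^ℚ (N ℕ.∸ i)) ⟩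
    ℕ→ℚ (N choose i) *ℚ a (suc i) *ℚ x ^ℚ (N ℕ.∸ i) +ℚ upper i
      ∎

appell-translate : ∀ N a x y → appell N a (x +ℚ y) ≡ appell N (λ i → appell i a x) y
appell-translate zero a x y = trans (appell-0 a (x +ℚ y)) (sym (trans (appell-0 (λ i → appell i a x) y) (appell-0 a x)))
appell-translate (suc N) a x y = begin
  appell (suc N) a (x +ℚ y)                                     ≡⟨ appell-suc N a (x +ℚ y) ⟩
  (x +ℚ y) *ℚ appell N a (x +ℚ y) +ℚ appell N a′ (x +ℚ y)       ≡⟨ cong₂ (λ u v → (x +ℚ y) *ℚ u +ℚ v) (appell-translate N a x y) (appell-translate N a′ x y) ⟩
  (x +ℚ y) *ℚ appell N S y +ℚ appell N S′ y                     ≡⟨ solve 4 (λ x y p q → (x :+ y) :* p :+ q := y :* p :+ (x :* p :+ q)) refl x y (appell N S y) (appell N S′ y) ⟩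
  y *ℚ appell N S y +ℚ (x *ℚ appell N S y +ℚ appell N S′ y)     ≡⟨ cong (λ u → y *ℚ appell N S y +ℚ (u +ℚ appell N S′ y)) (appell-*ˡ N x S y) ⟨
  y *ℚ appell N S y +ℚ (appell N (λ i → x *ℚ S i) y +ℚ appell N S′ y) ≡⟨ cong (y *ℚ appell N S y +ℚ_) (appell-+ N (λ i → x *ℚ S i) S′ y) ⟨
  y *ℚ appell N S y +ℚ appell N (λ i → x *ℚ S i +ℚ S′ i) y      ≡⟨ cong (y *ℚ appell N S y +ℚ_) (appell-cong N y (λ i → appell-suc i a x)) ⟨
  y *ℚ appell N S y +ℚ appell N (λ i → S (suc i)) y             ≡⟨ appell-suc N S y ⟨
  appell (suc N) S y                                            ∎
  where
  a′ S S′ : ℕ → ℚ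
  a′ i = a (suc i)
  S  i = appell i a x
  S′ i = appell i a′ x

appell-at-0 : ∀ N a → appell N a 0ℚ ≡ a N
appell-at-0 zero    a = appell-0 a 0ℚ
appell-at-0 (suc N) a = begin
  appell (suc N) a 0ℚ                                     ≡⟨ appell-suc N a 0ℚ ⟩
  0ℚ *ℚ appell N a 0ℚ +ℚ appell N (λ i → a (suc i)) 0ℚ   ≡⟨ cong₂ _+ℚ_ (ℚP.*-zeroˡ (appell N a 0ℚ)) (appell-at-0 N (λ i → a (suc i))) ⟩
  0ℚ +ℚ a (suc N)                                         ≡⟨ ℚP.+-identityˡ (a (suc N)) ⟩
  a (suc N)                                               ∎

appell-at-1 : ∀ N a → appell N a 1ℚ ≡ Σ< (suc N) (λ i → ℕ→ℚ (N choose i) *ℚ a i)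
appell-at-1 N a = Σ<-cong (suc N) {g = λ i → ℕ→ℚ (N choose i) *ℚ a i} (λ i _ →
  trans (cong (ℕ→ℚ (N choose i) *ℚ a i *ℚ_) (1^ℚ≡1 (N ℕ.∸ i))) (ℚP.*-identityʳ _))

appell-dilate : ∀ N a s t x → s *ℚ t ≡ 1ℚ → s ^ℚ N *ℚ appell N a (t *ℚ x) ≡ appell N (λ i → s ^ℚ i *ℚ a i) x
appell-dilate zero a s t x st≡1 = begin
  1ℚ *ℚ appell 0 a (t *ℚ x)              ≡⟨ ℚP.*-identityˡ _ ⟩
  appell 0 a (t *ℚ x)                    ≡⟨ appell-0 a (t *ℚ x) ⟩
  a 0                                    ≡⟨ ℚP.*-identityˡ (a 0) ⟨
  1ℚ *ℚ a 0                              ≡⟨ appell-0 (λ i → s ^ℚ i *ℚ a i) x ⟨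
  appell 0 (λ i → s ^ℚ i *ℚ a i) x       ∎
appell-dilate (suc N) a s t x st≡1 = begin
  s *ℚ s ^ℚ N *ℚ appell (suc N) a (t *ℚ x)         ≡⟨ cong (s *ℚ s ^ℚ N *ℚ_) (appell-suc N a (t *ℚ x)) ⟩
  s *ℚ s ^ℚ N *ℚ (t *ℚ x *ℚ P +ℚ P′)
    ≡⟨ solve 6 (λ s sN t x P Q → s :* sN :* (t :* x :* P :+ Q) := s :* t :* x :* (sN :* P) :+ s :* (sN :* Q)) refl s (s ^ℚ N) t x P P′ ⟩
  s *ℚ t *ℚ x *ℚ (s ^ℚ N *ℚ P) +ℚ s *ℚ (s ^ℚ N *ℚ P′)
    ≡⟨ cong₂ (λ u v → u *ℚ x *ℚ v +ℚ s *ℚ (s ^ℚ N *ℚ P′)) st≡1 (appell-dilate N a s t x st≡1) ⟩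
  1ℚ *ℚ x *ℚ appell N b x +ℚ s *ℚ (s ^ℚ N *ℚ P′)
    ≡⟨ cong₂ (λ u v → u *ℚ appell N b x +ℚ s *ℚ v) (ℚP.*-identityˡ x) (appell-dilate N (λ i → a (suc i)) s t x st≡1) ⟩
  x *ℚ appell N b x +ℚ s *ℚ appell N (λ i → s ^ℚ i *ℚ a (suc i)) x
    ≡⟨ cong (x *ℚ appell N b x +ℚ_) (appell-*ˡ N s (λ i → s ^ℚ i *ℚ a (suc i)) x) ⟨
  x *ℚ appell N b x +ℚ appell N (λ i → s *ℚ (s ^ℚ i *ℚ a (suc i))) x
    ≡⟨ cong (x *ℚ appell N b x +ℚ_) (appell-cong N x (λ i → ℚP.*-assoc s (s ^ℚ i) (a (suc i)))) ⟨
  x *ℚ appell N b x +ℚ appell N (λ i → b (suc i)) x ≡⟨ appell-suc N b x ⟨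
  appell (suc N) b x                                ∎
  where
  P P′ : ℚ
  P  = appell N a (t *ℚ x)
  P′ = appell N (λ i → a (suc i)) (t *ℚ x)
  b : ℕ → ℚ
  b i = s ^ℚ i *ℚ a i

Σ<-appell-translates : ∀ M N a s t x → s *ℚ t ≡ 1ℚ →
  s ^ℚ N *ℚ Σ< M (λ c → appell N a ((x +ℚ ℕ→ℚ c) *ℚ t))
    ≡ appell N (λ i → s ^ℚ i *ℚ Σ< M (λ c → appell i a (ℕ→ℚ c *ℚ t))) x
Σ<-appell-translates M N a s t x st≡1 = begin
  s ^ℚ N *ℚ Σ< M (λ c → appell N a ((x +ℚ ℕ→ℚ c) *ℚ t))
    ≡⟨ Σ<-*ˡ M (s ^ℚ N) (λ c → appell N a ((x +ℚ ℕ→ℚ c) *ℚ t)) ⟨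
  Σ< M (λ c → s ^ℚ N *ℚ appell N a ((x +ℚ ℕ→ℚ c) *ℚ t))
    ≡⟨ Σ<-cong M (λ c _ → cong (λ u → s ^ℚ N *ℚ appell N a u)
         (solve 3 (λ x c t → (x :+ c) :* t := c :* t :+ t :* x) refl x (ℕ→ℚ c) t)) ⟩
  Σ< M (λ c → s ^ℚ N *ℚ appell N a (ℕ→ℚ c *ℚ t +ℚ t *ℚ x))
    ≡⟨ Σ<-cong M (λ c _ → cong (s ^ℚ N *ℚ_) (appell-translate N a (ℕ→ℚ c *ℚ t) (t *ℚ x))) ⟩
  Σ< M (λ c → s ^ℚ N *ℚ appell N (λ i → appell i a (ℕ→ℚ c *ℚ t)) (t *ℚ x))
    ≡⟨ Σ<-cong M (λ c _ → appell-dilate N (λ i → appell i a (ℕ→ℚ c *ℚ t)) s t x st≡1) ⟩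
  Σ< M (λ c → appell N (λ i → s ^ℚ i *ℚ appell i a (ℕ→ℚ c *ℚ t)) x)
    ≡⟨ Σ<-appell M N (λ c i → s ^ℚ i *ℚ appell i a (ℕ→ℚ c *ℚ t)) x ⟩
  appell N (λ i → Σ< M (λ c → s ^ℚ i *ℚ appell i a (ℕ→ℚ c *ℚ t))) x
    ≡⟨ appell-cong N x (λ i → Σ<-*ˡ M (s ^ℚ i) (λ c → appell i a (ℕ→ℚ c *ℚ t))) ⟩
  appell N (λ i → s ^ℚ i *ℚ Σ< M (λ c → appell i a (ℕ→ℚ c *ℚ t))) x
    ∎

appell-suc-at-1 : ∀ K a → appell (suc K) a 1ℚ ≡ Σ< (suc K) (λ j → ℕ→ℚ (suc K choose j) *ℚ a j) +ℚ a (suc K)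
appell-suc-at-1 K a = begin
  appell (suc K) a 1ℚ
    ≡⟨ appell-at-1 (suc K) a ⟩
  Σ< (suc (suc K)) (λ j → ℕ→ℚ (suc K choose j) *ℚ a j)
    ≡⟨ Σ<-suc (suc K) (λ j → ℕ→ℚ (suc K choose j) *ℚ a j) ⟩
  Σ< (suc K) (λ j → ℕ→ℚ (suc K choose j) *ℚ a j) +ℚ ℕ→ℚ (suc K choose suc K) *ℚ a (suc K)
    ≡⟨ cong (λ c → Σ< (suc K) (λ j → ℕ→ℚ (suc K choose j) *ℚ a j) +ℚ ℕ→ℚ c *ℚ a (suc K)) (nCn≡1 (suc K)) ⟩
  Σ< (suc K) (λ j → ℕ→ℚ (suc K choose j) *ℚ a j) +ℚ 1ℚ *ℚ a (suc K)
    ≡⟨ cong (Σ< (suc K) (λ j → ℕ→ℚ (suc K choose j) *ℚ a j) +ℚ_) (ℚP.*-identityˡ (a (suc K))) ⟩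
  Σ< (suc K) (λ j → ℕ→ℚ (suc K choose j) *ℚ a j) +ℚ a (suc K)
    ∎

[1+n]Cn≡1+n : ∀ n → suc n choose n ≡ suc n
[1+n]Cn≡1+n n = trans (nCk≡nC[n∸k] (ℕP.n≤1+n n)) (trans (cong (suc n choose_) (ℕP.m+n∸n≡m 1 n)) (nC1≡n (suc n)))

Σ<-binomial-last : ∀ K (a : ℕ → ℚ) → Σ< (suc K) (λ j → ℕ→ℚ (suc K choose j) *ℚ a j)
                             ≡ Σ< K (λ j → ℕ→ℚ (suc K choose j) *ℚ a j) +ℚ ℕ→ℚ (suc K) *ℚ a K
Σ<-binomial-last K a = trans (Σ<-suc K (λ j → ℕ→ℚ (suc K choose j) *ℚ a j))
  (cong (λ c → Σ< K (λ j → ℕ→ℚ (suc K choose j) *ℚ a j) +ℚ ℕ→ℚ c *ℚ a K) ([1+n]Cn≡1+n K))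

appell-fixed-at-1⇒zero : ∀ d → (∀ N → appell N d 1ℚ ≡ d N) → ∀ K → d K ≡ 0ℚ
appell-fixed-at-1⇒zero d fixed = <-rec (λ K → d K ≡ 0ℚ) step
  where
  step : ∀ K → (∀ {j} → j < K → d j ≡ 0ℚ) → d K ≡ 0ℚ
  step K ih = *-cancelˡ (ℕ→ℚ (suc K)) (ℕ→ℚ-suc≢0 K) (begin
    ℕ→ℚ (suc K) *ℚ d K                                         ≡⟨ ℚP.+-identityˡ _ ⟨
    0ℚ +ℚ ℕ→ℚ (suc K) *ℚ d K                                   ≡⟨ cong (_+ℚ ℕ→ℚ (suc K) *ℚ d K) lower≡0 ⟨
    Σ< K (λ j → ℕ→ℚ (suc K choose j) *ℚ d j) +ℚ ℕ→ℚ (suc K) *ℚ d K ≡⟨ Σ<-binomial-last K d ⟨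
    Σ< (suc K) (λ j → ℕ→ℚ (suc K choose j) *ℚ d j)             ≡⟨ solve 2 (λ S a → S := S :+ a :- a) refl _ (d (suc K)) ⟩
    Σ< (suc K) (λ j → ℕ→ℚ (suc K choose j) *ℚ d j) +ℚ d (suc K) -ℚ d (suc K)
      ≡⟨ cong (_-ℚ d (suc K)) (trans (sym (appell-suc-at-1 K d)) (fixed (suc K))) ⟩
    d (suc K) -ℚ d (suc K)                                     ≡⟨ ℚP.+-inverseʳ (d (suc K)) ⟩
    0ℚ                                                         ≡⟨ ℚP.*-zeroʳ (ℕ→ℚ (suc K)) ⟨
    ℕ→ℚ (suc K) *ℚ 0ℚ                                          ∎)
    where
    lower≡0 : Σ< K (λ j → ℕ→ℚ (suc K choose j) *ℚ d j) ≡ 0ℚ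
    lower≡0 = trans (Σ<-cong K (λ j j<K → trans (cong (ℕ→ℚ (suc K choose j) *ℚ_) (ih j<K)) (ℚP.*-zeroʳ (ℕ→ℚ (suc K choose j)))))
                    (Σ<-zero K)

-- Bernoulli numbers and polynomials

zipWith-map-diag : ∀ {A B C : Set} (f : A → B → C) (g : A → B) xs →
  List.zipWith f xs (map g xs) ≡ map (λ x → f x (g x)) xs
zipWith-map-diag f g []       = refl
zipWith-map-diag f g (x ∷ xs) = cong (f x (g x) ∷_) (zipWith-map-diag f g xs)

bernoulli-suc-unfold : ∀ m → bernoulli (suc m) ≡ ℚ.- (inv (ℕ→ℚ (suc (suc m))) *ℚ
  Σℚ (List.zipWith (λ j b → ℕ→ℚ (suc (suc m) choose j) *ℚ b) (upTo (suc m)) (bernUpTo m)))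
bernoulli-suc-unfold m = cong (List.foldr (λ x _ → x) 0ℚ) (ListP.reverse-++ (bernUpTo m) (_ ∷ []))

bernUpTo≡map : ∀ m → bernUpTo m ≡ map bernoulli (upTo (suc m))
bernUpTo≡map zero    = refl
bernUpTo≡map (suc m) = begin
  bernUpTo m List.++ _ ∷ []                                       ≡⟨ cong₂ (λ l b → l List.++ b ∷ []) (bernUpTo≡map m) (sym (bernoulli-suc-unfold m)) ⟩
  map bernoulli (upTo (suc m)) List.++ map bernoulli (suc m ∷ []) ≡⟨ ListP.map-++ bernoulli (upTo (suc m)) (suc m ∷ []) ⟨
  map bernoulli (upTo (suc m) List.++ suc m ∷ [])                 ≡⟨ cong (map bernoulli) (ListP.upTo-∷ʳ (suc m)) ⟩
  map bernoulli (upTo (suc (suc m)))                              ∎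

bernoulli-suc : ∀ m → bernoulli (suc m)
  ≡ ℚ.- (inv (ℕ→ℚ (suc (suc m))) *ℚ Σ< (suc m) (λ j → ℕ→ℚ (suc (suc m) choose j) *ℚ bernoulli j))
bernoulli-suc m = trans (bernoulli-suc-unfold m) (cong (λ l → ℚ.- (inv (ℕ→ℚ (suc (suc m))) *ℚ Σℚ l))
  (trans (cong (List.zipWith (λ j b → ℕ→ℚ (suc (suc m) choose j) *ℚ b) (upTo (suc m))) (bernUpTo≡map m))
         (zipWith-map-diag (λ j b → ℕ→ℚ (suc (suc m) choose j) *ℚ b) bernoulli (upTo (suc m)))))

bernoulli-recurrence : ∀ m → Σ< (suc (suc m)) (λ j → ℕ→ℚ (suc (suc m) choose j) *ℚ bernoulli j) ≡ 0ℚ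
bernoulli-recurrence m = begin
  Σ< (suc (suc m)) (λ j → ℕ→ℚ (suc (suc m) choose j) *ℚ bernoulli j) ≡⟨ Σ<-binomial-last (suc m) bernoulli ⟩
  S +ℚ q *ℚ bernoulli (suc m)                 ≡⟨ cong (λ b → S +ℚ q *ℚ b) (bernoulli-suc m) ⟩
  S +ℚ q *ℚ ℚ.- (inv q *ℚ S)                  ≡⟨ solve 3 (λ S q i → S :+ q :* (:- (i :* S)) := S :- q :* i :* S) refl S q (inv q) ⟩
  S -ℚ q *ℚ inv q *ℚ S                        ≡⟨ cong (λ u → S -ℚ u *ℚ S) (inv-inverseʳ q (ℕ→ℚ-suc≢0 (suc m))) ⟩
  S -ℚ 1ℚ *ℚ S                                ≡⟨ solve 1 (λ S → S :- con 1ℚ :* S := con 0ℚ) refl S ⟩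
  0ℚ                                          ∎
  where
  S = Σ< (suc m) (λ j → ℕ→ℚ (suc (suc m) choose j) *ℚ bernoulli j)
  q = ℕ→ℚ (suc (suc m))

bernPoly-at-1 : ∀ m → bernPoly (suc (suc m)) 1ℚ ≡ bernoulli (suc (suc m))
bernPoly-at-1 m = begin
  bernPoly (suc (suc m)) 1ℚ
    ≡⟨ appell-suc-at-1 (suc m) bernoulli ⟩
  Σ< (suc (suc m)) (λ j → ℕ→ℚ (suc (suc m) choose j) *ℚ bernoulli j) +ℚ bernoulli (suc (suc m))
    ≡⟨ cong (_+ℚ bernoulli (suc (suc m))) (bernoulli-recurrence m) ⟩
  0ℚ +ℚ bernoulli (suc (suc m))
    ≡⟨ ℚP.+-identityˡ (bernoulli (suc (suc m))) ⟩
  bernoulli (suc (suc m))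
    ∎

bernPoly-at-1-defect : ∀ s N → (s ^ℚ N -ℚ s) *ℚ (bernPoly N 1ℚ -ℚ bernoulli N) ≡ 0ℚ
bernPoly-at-1-defect s zero = begin
  (1ℚ -ℚ s) *ℚ (bernPoly 0 1ℚ -ℚ bernoulli 0)   ≡⟨ cong (λ b → (1ℚ -ℚ s) *ℚ (b -ℚ bernoulli 0)) (appell-0 bernoulli 1ℚ) ⟩
  (1ℚ -ℚ s) *ℚ (bernoulli 0 -ℚ bernoulli 0)     ≡⟨ cong ((1ℚ -ℚ s) *ℚ_) (ℚP.+-inverseʳ (bernoulli 0)) ⟩
  (1ℚ -ℚ s) *ℚ 0ℚ                              ≡⟨ ℚP.*-zeroʳ (1ℚ -ℚ s) ⟩
  0ℚ                                           ∎
bernPoly-at-1-defect s (suc zero) = begin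
  (s *ℚ 1ℚ -ℚ s) *ℚ (bernPoly 1 1ℚ -ℚ bernoulli 1) ≡⟨ solve 2 (λ s b → (s :* con 1ℚ :- s) :* b := con 0ℚ) refl s (bernPoly 1 1ℚ -ℚ bernoulli 1) ⟩
  0ℚ                                               ∎
bernPoly-at-1-defect s (suc (suc m)) = begin
  (s ^ℚ suc (suc m) -ℚ s) *ℚ (bernPoly (suc (suc m)) 1ℚ -ℚ bernoulli (suc (suc m)))
    ≡⟨ cong (λ b → (s ^ℚ suc (suc m) -ℚ s) *ℚ (b -ℚ bernoulli (suc (suc m)))) (bernPoly-at-1 m) ⟩
  (s ^ℚ suc (suc m) -ℚ s) *ℚ (bernoulli (suc (suc m)) -ℚ bernoulli (suc (suc m)))
    ≡⟨ cong ((s ^ℚ suc (suc m) -ℚ s) *ℚ_) (ℚP.+-inverseʳ (bernoulli (suc (suc m)))) ⟩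
  (s ^ℚ suc (suc m) -ℚ s) *ℚ 0ℚ
    ≡⟨ ℚP.*-zeroʳ (s ^ℚ suc (suc m) -ℚ s) ⟩
  0ℚ ∎

-- Periodic Bernoulli functions

floor-bounds : ∀ p → ℤ→ℚ (ℚ.floor p) ℚ.≤ p × p ℚ.< ℤ→ℚ (ℤ.suc (ℚ.floor p))
floor-bounds p@(ℚ.mkℚ n d _) = lower , upper
  where
  D f : ℤ
  D = + suc d
  f = ℚ.floor p
  n≡r+f*D : n ℤ.* + 1 ≡ + (n ℤ÷.% D) ℤ.+ f ℤ.* D
  n≡r+f*D = trans (ℤP.*-identityʳ n) (ℤ÷.a≡a%n+[a/n]*n n D)
  lower : ℤ→ℚ f ℚ.≤ p
  lower = subst (ℚ._≤ p) (sym (ℤ→ℚ≡mkℚ f))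
    (ℚ.*≤* (subst (f ℤ.* D ℤ.≤_) (sym n≡r+f*D) (ℤP.i≤j+i (f ℤ.* D) (+ (n ℤ÷.% D)))))
  upper : p ℚ.< ℤ→ℚ (ℤ.suc f)
  upper = subst (p ℚ.<_) (sym (ℤ→ℚ≡mkℚ (ℤ.suc f)))
    (ℚ.*<* (subst₂ ℤ._<_ (sym n≡r+f*D) (sym (ℤP.suc-* f D))
      (ℤP.+-monoˡ-< (f ℤ.* D) (ℤ.+<+ (ℤ÷.n%d<d n D)))))

<1+⇒≤ : ∀ {a b} → a ℤ.< ℤ.suc b → a ℤ.≤ b
<1+⇒≤ {a} {b} a<1+b = subst (a ℤ.≤_) (ℤP.pred-suc b) (ℤP.i<j⇒i≤pred[j] a<1+b)

floor-unique : ∀ p z → ℤ→ℚ z ℚ.≤ p → p ℚ.< ℤ→ℚ (ℤ.suc z) → ℚ.floor p ≡ z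
floor-unique p z z≤p p<1+z = ℤP.≤-antisym
  (<1+⇒≤ (ℤ→ℚ-cancel-< (ℚP.≤-<-trans (proj₁ (floor-bounds p)) p<1+z)))
  (<1+⇒≤ (ℤ→ℚ-cancel-< (ℚP.≤-<-trans z≤p (proj₂ (floor-bounds p)))))

frac-bounds : ∀ x → 0ℚ ℚ.≤ x -ℚ ℤ→ℚ (ℚ.floor x) × x -ℚ ℤ→ℚ (ℚ.floor x) ℚ.< 1ℚ
frac-bounds x = lower , upper
  where
  f = ℤ→ℚ (ℚ.floor x)
  lower : 0ℚ ℚ.≤ x -ℚ f
  lower = subst (ℚ._≤ x -ℚ f) (ℚP.+-inverseʳ f) (ℚP.+-monoˡ-≤ (ℚ.- f) (proj₁ (floor-bounds x)))
  upper : x -ℚ f ℚ.< 1ℚ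
  upper = subst (x -ℚ f ℚ.<_) (trans (cong (_-ℚ f) (ℤ→ℚ-suc (ℚ.floor x))) (solve 1 (λ f → con 1ℚ :+ f :- f := con 1ℚ) refl f))
    (ℚP.+-monoˡ-< (ℚ.- f) (proj₂ (floor-bounds x)))

bernBar-between : ∀ N y z → ℤ→ℚ z ℚ.≤ y → y ℚ.< ℤ→ℚ (ℤ.suc z) → bernBar N y ≡ bernPoly N (y -ℚ ℤ→ℚ z)
bernBar-between N y z z≤y y<1+z = cong (λ u → bernPoly N (y -ℚ ℤ→ℚ u)) (floor-unique y z z≤y y<1+z)

bernBar-periodic : ∀ N y → bernBar N (y +ℚ 1ℚ) ≡ bernBar N y
bernBar-periodic N y = begin
  bernBar N (y +ℚ 1ℚ)                         ≡⟨ bernBar-between N (y +ℚ 1ℚ) (ℤ.suc f) lower upper ⟩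
  bernPoly N (y +ℚ 1ℚ -ℚ ℤ→ℚ (ℤ.suc f))       ≡⟨ cong (λ u → bernPoly N (y +ℚ 1ℚ -ℚ u)) (ℤ→ℚ-suc f) ⟩
  bernPoly N (y +ℚ 1ℚ -ℚ (1ℚ +ℚ ℤ→ℚ f))       ≡⟨ cong (bernPoly N) (solve 2 (λ y f → y :+ con 1ℚ :- (con 1ℚ :+ f) := y :- f) refl y (ℤ→ℚ f)) ⟩
  bernBar N y                                 ∎
  where
  f = ℚ.floor y
  lower : ℤ→ℚ (ℤ.suc f) ℚ.≤ y +ℚ 1ℚ
  lower = subst₂ ℚ._≤_ (sym (ℤ→ℚ-suc f)) (ℚP.+-comm 1ℚ y) (ℚP.+-monoʳ-≤ 1ℚ (proj₁ (floor-bounds y)))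
  upper : y +ℚ 1ℚ ℚ.< ℤ→ℚ (ℤ.suc (ℤ.suc f))
  upper = subst₂ ℚ._<_ (ℚP.+-comm 1ℚ y) (sym (ℤ→ℚ-suc (ℤ.suc f))) (ℚP.+-monoʳ-< 1ℚ (proj₂ (floor-bounds y)))

bernBar-at-0 : ∀ N → bernBar N 0ℚ ≡ bernoulli N
bernBar-at-0 N = appell-at-0 N bernoulli

module _ (f : ℚ → ℚ) (1-periodic : ∀ y → f (y +ℚ 1ℚ) ≡ f y) where

  ℕ-periodic : ∀ n y → f (y +ℚ ℕ→ℚ n) ≡ f y
  ℕ-periodic zero    y = cong f (ℚP.+-identityʳ y)
  ℕ-periodic (suc n) y = begin
    f (y +ℚ ℕ→ℚ (suc n))   ≡⟨ cong f (trans (cong (y +ℚ_) (ℕ→ℚ-suc n))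
                                (solve 2 (λ y n → y :+ (con 1ℚ :+ n) := y :+ n :+ con 1ℚ) refl y (ℕ→ℚ n))) ⟩
    f (y +ℚ ℕ→ℚ n +ℚ 1ℚ)   ≡⟨ 1-periodic (y +ℚ ℕ→ℚ n) ⟩
    f (y +ℚ ℕ→ℚ n)         ≡⟨ ℕ-periodic n y ⟩
    f y                    ∎

  ℤ-periodic : ∀ z y → f (y +ℚ ℤ→ℚ z) ≡ f y
  ℤ-periodic (+ n)      y = ℕ-periodic n y
  ℤ-periodic ℤ.-[1+ n ] y = begin
    f (y +ℚ ℤ→ℚ ℤ.-[1+ n ])                     ≡⟨ ℕ-periodic (suc n) (y +ℚ ℤ→ℚ ℤ.-[1+ n ]) ⟨
    f (y +ℚ ℤ→ℚ ℤ.-[1+ n ] +ℚ ℕ→ℚ (suc n))      ≡⟨ cong f (trans (ℚP.+-assoc y (ℤ→ℚ ℤ.-[1+ n ]) (ℕ→ℚ (suc n))) (cong (y +ℚ_) -[1+n]+[1+n]≡0)) ⟩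
    f (y +ℚ 0ℚ)                                 ≡⟨ cong f (ℚP.+-identityʳ y) ⟩
    f y                                         ∎
    where
    -[1+n]+[1+n]≡0 : ℤ→ℚ ℤ.-[1+ n ] +ℚ ℕ→ℚ (suc n) ≡ 0ℚ
    -[1+n]+[1+n]≡0 = trans (sym (ℤ→ℚ-homo-+ ℤ.-[1+ n ] (+ suc n))) (cong ℤ→ℚ (ℤP.+-inverseˡ (+ suc n)))

-- Raabe's multiplication formula and the distribution relation

module _ (m : ℕ) where
  private
    s t : ℚ
    s = ℕ→ℚ (suc m)
    t = inv s

    s*t≡1 : s *ℚ t ≡ 1ℚ
    s*t≡1 = inv-inverseʳ s (ℕ→ℚ-suc≢0 m)

    g : ℕ → ℚ
    g i = s ^ℚ i *ℚ Σ< (suc m) (λ c → bernPoly i (ℕ→ℚ c *ℚ t))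

    appell-g-at-1 : ∀ N → appell N g 1ℚ ≡ g N +ℚ s ^ℚ N *ℚ (bernPoly N 1ℚ -ℚ bernoulli N)
    appell-g-at-1 N = begin
      appell N g 1ℚ
        ≡⟨ Σ<-appell-translates (suc m) N bernoulli s t 1ℚ s*t≡1 ⟨
      s ^ℚ N *ℚ Σ< (suc m) (λ c → bernPoly N ((1ℚ +ℚ ℕ→ℚ c) *ℚ t))
        ≡⟨ cong (s ^ℚ N *ℚ_) (Σ<-cong (suc m) (λ c _ → cong (λ u → f (u *ℚ t)) (sym (ℕ→ℚ-suc c)))) ⟩
      s ^ℚ N *ℚ Σ< (suc m) (λ c → f (ℕ→ℚ (suc c) *ℚ t))
        ≡⟨ cong (s ^ℚ N *ℚ_) (Σ<-telescope (suc m) (λ c → f (ℕ→ℚ c *ℚ t))) ⟩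
      s ^ℚ N *ℚ (Σ< (suc m) (λ c → f (ℕ→ℚ c *ℚ t)) +ℚ f (s *ℚ t) -ℚ f (0ℚ *ℚ t))
        ≡⟨ cong₂ (λ u v → s ^ℚ N *ℚ (Σ< (suc m) (λ c → f (ℕ→ℚ c *ℚ t)) +ℚ f u -ℚ v)) s*t≡1 f[0]≡B ⟩
      s ^ℚ N *ℚ (Σ< (suc m) (λ c → f (ℕ→ℚ c *ℚ t)) +ℚ f 1ℚ -ℚ bernoulli N)
        ≡⟨ solve 4 (λ sN S P b → sN :* (S :+ P :- b) := sN :* S :+ sN :* (P :- b)) refl
             (s ^ℚ N) (Σ< (suc m) (λ c → f (ℕ→ℚ c *ℚ t))) (f 1ℚ) (bernoulli N) ⟩
      g N +ℚ s ^ℚ N *ℚ (bernPoly N 1ℚ -ℚ bernoulli N)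
        ∎
      where
      f : ℚ → ℚ
      f = bernPoly N
      f[0]≡B : f (0ℚ *ℚ t) ≡ bernoulli N
      f[0]≡B = trans (cong f (ℚP.*-zeroˡ t)) (appell-at-0 N bernoulli)

  raabe-at-0 : ∀ i → ℕ→ℚ (suc m) ^ℚ i *ℚ Σ< (suc m) (λ c → bernPoly i (ℕ→ℚ c *ℚ inv (ℕ→ℚ (suc m))))
                     ≡ ℕ→ℚ (suc m) *ℚ bernoulli i
  raabe-at-0 i = begin
    g i                           ≡⟨ solve 3 (λ g s b → g := (g :+ (:- s) :* b) :+ s :* b) refl (g i) s (bernoulli i) ⟩
    d i +ℚ s *ℚ bernoulli i       ≡⟨ cong (_+ℚ s *ℚ bernoulli i) (appell-fixed-at-1⇒zero d d-fixed i) ⟩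
    0ℚ +ℚ s *ℚ bernoulli i        ≡⟨ ℚP.+-identityˡ (s *ℚ bernoulli i) ⟩
    s *ℚ bernoulli i              ∎
    where
    d : ℕ → ℚ
    d i = g i +ℚ ℚ.- s *ℚ bernoulli i
    d-fixed : ∀ N → appell N d 1ℚ ≡ d N
    d-fixed N = begin
      appell N d 1ℚ
        ≡⟨ appell-+ N g (λ i → ℚ.- s *ℚ bernoulli i) 1ℚ ⟩
      appell N g 1ℚ +ℚ appell N (λ i → ℚ.- s *ℚ bernoulli i) 1ℚ
        ≡⟨ cong₂ _+ℚ_ (appell-g-at-1 N) (appell-*ˡ N (ℚ.- s) bernoulli 1ℚ) ⟩
      g N +ℚ s ^ℚ N *ℚ (P -ℚ bernoulli N) +ℚ ℚ.- s *ℚ P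
        ≡⟨ solve 5 (λ gN s sN P b → gN :+ sN :* (P :- b) :+ (:- s) :* P := gN :+ (:- s) :* b :+ (sN :- s) :* (P :- b))
             refl (g N) s (s ^ℚ N) P (bernoulli N) ⟩
      d N +ℚ (s ^ℚ N -ℚ s) *ℚ (P -ℚ bernoulli N)
        ≡⟨ cong (d N +ℚ_) (bernPoly-at-1-defect s N) ⟩
      d N +ℚ 0ℚ
        ≡⟨ ℚP.+-identityʳ (d N) ⟩
      d N
        ∎
      where
      P = bernPoly N 1ℚ

  raabe : ∀ N x → ℕ→ℚ (suc m) ^ℚ N *ℚ Σ< (suc m) (λ c → bernPoly N ((x +ℚ ℕ→ℚ c) *ℚ inv (ℕ→ℚ (suc m))))
                  ≡ ℕ→ℚ (suc m) *ℚ bernPoly N x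
  raabe N x = begin
    s ^ℚ N *ℚ Σ< (suc m) (λ c → bernPoly N ((x +ℚ ℕ→ℚ c) *ℚ t)) ≡⟨ Σ<-appell-translates (suc m) N bernoulli s t x s*t≡1 ⟩
    appell N g x                                                 ≡⟨ appell-cong N x raabe-at-0 ⟩
    appell N (λ i → s *ℚ bernoulli i) x                          ≡⟨ appell-*ˡ N s bernoulli x ⟩
    s *ℚ bernPoly N x                                            ∎

  private
    -- inv computes once ℕ→ℚ (suc m) is brought to normal form.
    t-positive : ℚ.Positive t
    t-positive = subst ℚ.Positive (cong inv (sym (ℤ→ℚ≡mkℚ (+ suc m)))) _

    average : ℕ → ℚ → ℚ
    average N x = Σ< (suc m) (λ b → bernBar N ((x +ℚ ℕ→ℚ b) *ℚ t))

    average-periodic : ∀ N x → average N (x +ℚ 1ℚ) ≡ average N x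
    average-periodic N x = begin
      average N (x +ℚ 1ℚ)                    ≡⟨ Σ<-cong (suc m) (λ b _ → cong (λ u → bernBar N (u *ℚ t))
                                                   (trans (ℚP.+-assoc x 1ℚ (ℕ→ℚ b)) (cong (x +ℚ_) (sym (ℕ→ℚ-suc b))))) ⟩
      Σ< (suc m) (λ b → term (suc b))        ≡⟨ Σ<-telescope (suc m) term ⟩
      average N x +ℚ term (suc m) -ℚ term 0  ≡⟨ cong (λ u → average N x +ℚ u -ℚ term 0) term[1+m]≡term[0] ⟩
      average N x +ℚ term 0 -ℚ term 0        ≡⟨ solve 2 (λ a b → a :+ b :- b := a) refl (average N x) (term 0) ⟩
      average N x                            ∎
      where
      term : ℕ → ℚ
      term b = bernBar N ((x +ℚ ℕ→ℚ b) *ℚ t)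
      term[1+m]≡term[0] : term (suc m) ≡ term 0
      term[1+m]≡term[0] = begin
        bernBar N ((x +ℚ s) *ℚ t)      ≡⟨ cong (bernBar N) (solve 3 (λ x s t → (x :+ s) :* t := x :* t :+ s :* t) refl x s t) ⟩
        bernBar N (x *ℚ t +ℚ s *ℚ t)   ≡⟨ cong (λ u → bernBar N (x *ℚ t +ℚ u)) s*t≡1 ⟩
        bernBar N (x *ℚ t +ℚ 1ℚ)       ≡⟨ bernBar-periodic N (x *ℚ t) ⟩
        bernBar N (x *ℚ t)             ≡⟨ cong (λ u → bernBar N (u *ℚ t)) (ℚP.+-identityʳ x) ⟨
        term 0                         ∎

    in-unit-interval : ∀ {r} b → 0ℚ ℚ.≤ r → r ℚ.< 1ℚ → b < suc m →
      0ℚ ℚ.≤ (r +ℚ ℕ→ℚ b) *ℚ t × (r +ℚ ℕ→ℚ b) *ℚ t ℚ.< 1ℚ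
    in-unit-interval {r} b 0≤r r<1 (ℕ.s≤s b≤m) = lower , upper
      where
      lower : 0ℚ ℚ.≤ (r +ℚ ℕ→ℚ b) *ℚ t
      lower = subst (ℚ._≤ (r +ℚ ℕ→ℚ b) *ℚ t) (ℚP.*-zeroˡ t)
        (ℚP.*-monoʳ-≤-nonNeg t {{ℚP.pos⇒nonNeg t {{t-positive}}}} (ℚP.+-mono-≤ 0≤r (ℤ→ℚ-mono-≤ {+ 0} {+ b} (ℤ.+≤+ ℕ.z≤n))))
      upper : (r +ℚ ℕ→ℚ b) *ℚ t ℚ.< 1ℚ
      upper = subst ((r +ℚ ℕ→ℚ b) *ℚ t ℚ.<_) s*t≡1 (ℚP.*-monoˡ-<-pos t {{t-positive}}
        (subst (r +ℚ ℕ→ℚ b ℚ.<_) (sym (ℕ→ℚ-suc m)) (ℚP.+-mono-<-≤ r<1 (ℤ→ℚ-mono-≤ {+ b} {+ m} (ℤ.+≤+ b≤m)))))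

  bernBar-distribution : ∀ N x → ℕ→ℚ (suc m) ^ℚ N *ℚ Σ< (suc m) (λ b → bernBar N ((x +ℚ ℕ→ℚ b) *ℚ inv (ℕ→ℚ (suc m))))
                                 ≡ ℕ→ℚ (suc m) *ℚ bernBar N x
  bernBar-distribution N x = begin
    s ^ℚ N *ℚ average N x                                      ≡⟨ cong (λ y → s ^ℚ N *ℚ average N y) (solve 2 (λ x f → x := x :- f :+ f) refl x (ℤ→ℚ ⌊x⌋)) ⟩
    s ^ℚ N *ℚ average N (r +ℚ ℤ→ℚ ⌊x⌋)                         ≡⟨ cong (s ^ℚ N *ℚ_) (ℤ-periodic (average N) (average-periodic N) ⌊x⌋ r) ⟩
    s ^ℚ N *ℚ average N r                                      ≡⟨ cong (s ^ℚ N *ℚ_) (Σ<-cong (suc m) bernBar≡bernPoly) ⟩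
    s ^ℚ N *ℚ Σ< (suc m) (λ b → bernPoly N ((r +ℚ ℕ→ℚ b) *ℚ t)) ≡⟨ raabe N r ⟩
    s *ℚ bernBar N x                                           ∎
    where
    ⌊x⌋ = ℚ.floor x
    r   = x -ℚ ℤ→ℚ ⌊x⌋
    bernBar≡bernPoly : ∀ b → b < suc m → bernBar N ((r +ℚ ℕ→ℚ b) *ℚ t) ≡ bernPoly N ((r +ℚ ℕ→ℚ b) *ℚ t)
    bernBar≡bernPoly b b<1+m with in-unit-interval b (proj₁ (frac-bounds x)) (proj₂ (frac-bounds x)) b<1+m
    ... | 0≤y , y<1 = trans (bernBar-between N _ (+ 0) 0≤y y<1) (cong (bernPoly N) (ℚP.+-identityʳ _))

bernBar-distribution-scaled : ∀ m a N x →
  ℕ→ℚ (suc m) ^ℚ (a + N) *ℚ Σ< (suc m) (λ b → bernBar (N + 1) ((x +ℚ ℕ→ℚ b) *ℚ inv (ℕ→ℚ (suc m))))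
    ≡ ℕ→ℚ (suc m) ^ℚ a *ℚ bernBar (N + 1) x
bernBar-distribution-scaled m a N x = *-cancelˡ s (ℕ→ℚ-suc≢0 m) (begin
  s *ℚ (s ^ℚ (a + N) *ℚ S)              ≡⟨ cong (λ u → s *ℚ (u *ℚ S)) (^ℚ-distribˡ-+-* s a N) ⟩
  s *ℚ (s ^ℚ a *ℚ s ^ℚ N *ℚ S)          ≡⟨ solve 4 (λ s sa sN S → s :* (sa :* sN :* S) := sa :* (sN :* (s :* con 1ℚ) :* S)) refl s (s ^ℚ a) (s ^ℚ N) S ⟩
  s ^ℚ a *ℚ (s ^ℚ N *ℚ s ^ℚ 1 *ℚ S)     ≡⟨ cong (λ u → s ^ℚ a *ℚ (u *ℚ S)) (^ℚ-distribˡ-+-* s N 1) ⟨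
  s ^ℚ a *ℚ (s ^ℚ (N + 1) *ℚ S)         ≡⟨ cong (s ^ℚ a *ℚ_) (bernBar-distribution m (N + 1) x) ⟩
  s ^ℚ a *ℚ (s *ℚ bernBar (N + 1) x)    ≡⟨ solve 3 (λ sa s B → sa :* (s :* B) := s :* (sa :* B)) refl (s ^ℚ a) s (bernBar (N + 1) x) ⟩
  s *ℚ (s ^ℚ a *ℚ bernBar (N + 1) x)    ∎)
  where
  s = ℕ→ℚ (suc m)
  S = Σ< (suc m) (λ b → bernBar (N + 1) ((x +ℚ ℕ→ℚ b) *ℚ inv s))

-- The Hecke operator

T-prime : ∀ {m} → Prime m → ∀ (F : ℕ → ℤ → ℚ) h k →
  T m F h k ≡ F h (+ m ℤ.* k) +ℚ Σ< m (λ b → F (m * h) (k ℤ.+ + b ℤ.* + h))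
T-prime {zero}        pr = ⊥-elim (¬prime[0] pr)
T-prime {suc zero}    pr = ⊥-elim (¬prime[1] pr)
T-prime {suc (suc j)} pr F h k = begin
  T m F h k                                                ≡⟨ Σℚ-filter (λ i → suc i ∣? m) block (upTo m) ⟩
  Σ< m term                                                ≡⟨ Σ<-sucˡ (suc j) term ⟩
  term 0 +ℚ Σ< (suc j) (λ i → term (suc i))                ≡⟨ cong (term 0 +ℚ_) (Σ<-suc j (λ i → term (suc i))) ⟩
  term 0 +ℚ (Σ< j (λ i → term (suc i)) +ℚ term (suc j))   ≡⟨ cong₂ (λ u v → term 0 +ℚ (u +ℚ v)) proper-divisors top-divisor ⟩
  term 0 +ℚ (0ℚ +ℚ Σ< m (λ b → F (m * h) (k ℤ.+ + b ℤ.* + h))) ≡⟨ cong₂ _+ℚ_ unit-divisor (ℚP.+-identityˡ _) ⟩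
  F h (+ m ℤ.* k) +ℚ Σ< m (λ b → F (m * h) (k ℤ.+ + b ℤ.* + h)) ∎
  where
  m = suc (suc j)
  block term : ℕ → ℚ
  block i = Σ< (suc i) (λ b → F (suc i * h) (+ (m ℕ./ suc i) ℤ.* k ℤ.+ + b ℤ.* + h))
  term i = if does (suc i ∣? m) then block i else 0ℚ

  unit-divisor : term 0 ≡ F h (+ m ℤ.* k)
  unit-divisor = begin
    term 0                                       ≡⟨ cong (λ z → if z then block 0 else 0ℚ) (dec-true (1 ∣? m) (1∣ m)) ⟩
    F (1 * h) (+ (m ℕ./ 1) ℤ.* k ℤ.+ + 0) +ℚ 0ℚ  ≡⟨ ℚP.+-identityʳ _ ⟩
    F (1 * h) (+ (m ℕ./ 1) ℤ.* k ℤ.+ + 0)        ≡⟨ cong₂ F (ℕP.*-identityˡ h) (trans (ℤP.+-identityʳ _) (cong (λ u → + u ℤ.* k) (ℕ÷.n/1≡n m))) ⟩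
    F h (+ m ℤ.* k)                              ∎

  proper-divisors : Σ< j (λ i → term (suc i)) ≡ 0ℚ
  proper-divisors = trans (Σ<-cong j (λ i i<j → cong (λ z → if z then block (suc i) else 0ℚ)
    (dec-false (suc (suc i) ∣? m) (λ d∣m → prime⇒¬composite pr (composite (ℕ.s≤s (ℕ.s≤s i<j)) d∣m)))))
    (Σ<-zero j)

  top-divisor : term (suc j) ≡ Σ< m (λ b → F (m * h) (k ℤ.+ + b ℤ.* + h))
  top-divisor = trans (cong (λ z → if z then block (suc j) else 0ℚ) (dec-true (m ∣? m) ∣-refl))
    (Σ<-cong m (λ b _ → cong (λ a → F (m * h) (a ℤ.+ + b ℤ.* + h))
      (trans (cong (λ u → + u ℤ.* k) (ℕ÷.n/n≡1 m)) (ℤP.*-identityˡ k))))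

[k+b*h]/[m*h]≡[k/h+b]/m : ∀ m h k b →
  ℤ→ℚ (k ℤ.+ + b ℤ.* + suc h) *ℚ inv (ℕ→ℚ (suc m * suc h))
    ≡ (ℤ→ℚ k *ℚ inv (ℕ→ℚ (suc h)) +ℚ ℕ→ℚ b) *ℚ inv (ℕ→ℚ (suc m))
[k+b*h]/[m*h]≡[k/h+b]/m m h k b = begin
  ℤ→ℚ (k ℤ.+ + b ℤ.* + suc h) *ℚ inv (ℕ→ℚ (suc m * suc h))
    ≡⟨ cong₂ _*ℚ_ (trans (ℤ→ℚ-homo-+ k (+ b ℤ.* + suc h)) (cong (ℤ→ℚ k +ℚ_) (ℤ→ℚ-homo-* (+ b) (+ suc h)))) (inv-ℕ→ℚ-* m h) ⟩
  (ℤ→ℚ k +ℚ ℕ→ℚ b *ℚ H) *ℚ (inv M *ℚ inv H)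
    ≡⟨ solve 5 (λ K b H t i → (K :+ b :* H) :* (t :* i) := (K :* i :+ b :* (H :* i)) :* t) refl (ℤ→ℚ k) (ℕ→ℚ b) H (inv M) (inv H) ⟩
  (ℤ→ℚ k *ℚ inv H +ℚ ℕ→ℚ b *ℚ (H *ℚ inv H)) *ℚ inv M
    ≡⟨ cong (λ u → (ℤ→ℚ k *ℚ inv H +ℚ ℕ→ℚ b *ℚ u) *ℚ inv M) (inv-inverseʳ H (ℕ→ℚ-suc≢0 h)) ⟩
  (ℤ→ℚ k *ℚ inv H +ℚ ℕ→ℚ b *ℚ 1ℚ) *ℚ inv M
    ≡⟨ cong (λ u → (ℤ→ℚ k *ℚ inv H +ℚ u) *ℚ inv M) (ℚP.*-identityʳ (ℕ→ℚ b)) ⟩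
  (ℤ→ℚ k *ℚ inv H +ℚ ℕ→ℚ b) *ℚ inv M
    ∎
  where
  M = ℕ→ℚ (suc m)
  H = ℕ→ℚ (suc h)

Σ<-E-translates : ∀ w n m h k → n ≤ w →
  Σ< (suc m) (λ b → E w n (suc m * suc h) (k ℤ.+ + b ℤ.* + suc h))
    ≡ Σ< (suc m) (λ b → I w n (suc m * suc h) (k ℤ.+ + b ℤ.* + suc h))
      -ℚ inv (ℕ→ℚ (n + 1)) *ℚ (ℕ→ℚ (suc m) ^ℚ tilde w n *ℚ bernBar (n + 1) (ℤ→ℚ k *ℚ inv (ℕ→ℚ (suc h)))) *ℚ ℕ→ℚ (suc h) ^ℚ w
      -ℚ inv (ℕ→ℚ (tilde w n + 1)) *ℚ (ℕ→ℚ (suc m) ^ℚ n *ℚ bernBar (tilde w n + 1) (ℤ→ℚ k *ℚ inv (ℕ→ℚ (suc h)))) *ℚ ℕ→ℚ (suc h) ^ℚ w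
      +ℚ ℕ→ℚ (suc m) ^ℚ (w + 1) *ℚ C w n *ℚ ℕ→ℚ (suc h) ^ℚ w
Σ<-E-translates w n m h k n≤w = begin
  Σ< (suc m) (λ b → E w n (suc m * suc h) (k ℤ.+ + b ℤ.* + suc h))
    ≡⟨ Σ<-cong (suc m) (λ b _ → cong₂ (λ y K → Iₘ b -ℚ i₁ *ℚ bernBar (n + 1) y *ℚ K -ℚ i₂ *ℚ bernBar (ñ + 1) y *ℚ K +ℚ C w n *ℚ K)
         ([k+b*h]/[m*h]≡[k/h+b]/m m h k b) power) ⟩
  Σ< (suc m) (λ b → Iₘ b -ℚ i₁ *ℚ X b *ℚ (s ^ℚ w *ℚ Hʷ) -ℚ i₂ *ℚ Y b *ℚ (s ^ℚ w *ℚ Hʷ) +ℚ C w n *ℚ (s ^ℚ w *ℚ Hʷ))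
    ≡⟨ Σ<-linear (suc m) Iₘ X Y i₁ i₂ (C w n) (s ^ℚ w *ℚ Hʷ) ⟩
  ΣI -ℚ i₁ *ℚ Σ< (suc m) X *ℚ (s ^ℚ w *ℚ Hʷ) -ℚ i₂ *ℚ Σ< (suc m) Y *ℚ (s ^ℚ w *ℚ Hʷ) +ℚ s *ℚ C w n *ℚ (s ^ℚ w *ℚ Hʷ)
    ≡⟨ solve 9 (λ SI i₁ i₂ SX SY s sw c H →
         SI :- i₁ :* SX :* (sw :* H) :- i₂ :* SY :* (sw :* H) :+ s :* c :* (sw :* H)
         := SI :- i₁ :* (sw :* SX) :* H :- i₂ :* (sw :* SY) :* H :+ sw :* (s :* con 1ℚ) :* c :* H)
         refl ΣI i₁ i₂ (Σ< (suc m) X) (Σ< (suc m) Y) s (s ^ℚ w) (C w n) Hʷ ⟩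
  ΣI -ℚ i₁ *ℚ (s ^ℚ w *ℚ Σ< (suc m) X) *ℚ Hʷ -ℚ i₂ *ℚ (s ^ℚ w *ℚ Σ< (suc m) Y) *ℚ Hʷ +ℚ s ^ℚ w *ℚ s ^ℚ 1 *ℚ C w n *ℚ Hʷ
    ≡⟨ cong₂ (λ u v → ΣI -ℚ i₁ *ℚ u *ℚ Hʷ -ℚ i₂ *ℚ v *ℚ Hʷ +ℚ s ^ℚ w *ℚ s ^ℚ 1 *ℚ C w n *ℚ Hʷ) distribution₁ distribution₂ ⟩
  ΣI -ℚ i₁ *ℚ (s ^ℚ ñ *ℚ bernBar (n + 1) x) *ℚ Hʷ -ℚ i₂ *ℚ (s ^ℚ n *ℚ bernBar (ñ + 1) x) *ℚ Hʷ +ℚ s ^ℚ w *ℚ s ^ℚ 1 *ℚ C w n *ℚ Hʷ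
    ≡⟨ cong (λ u → ΣI -ℚ i₁ *ℚ (s ^ℚ ñ *ℚ bernBar (n + 1) x) *ℚ Hʷ -ℚ i₂ *ℚ (s ^ℚ n *ℚ bernBar (ñ + 1) x) *ℚ Hʷ +ℚ u *ℚ C w n *ℚ Hʷ)
         (^ℚ-distribˡ-+-* s w 1) ⟨
  ΣI -ℚ i₁ *ℚ (s ^ℚ ñ *ℚ bernBar (n + 1) x) *ℚ Hʷ -ℚ i₂ *ℚ (s ^ℚ n *ℚ bernBar (ñ + 1) x) *ℚ Hʷ +ℚ s ^ℚ (w + 1) *ℚ C w n *ℚ Hʷ
    ∎
  where
  ñ = tilde w n
  s t H x Hʷ i₁ i₂ ΣI : ℚ
  s  = ℕ→ℚ (suc m)
  t  = inv s
  H  = ℕ→ℚ (suc h)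
  x  = ℤ→ℚ k *ℚ inv H
  Hʷ = H ^ℚ w
  i₁ = inv (ℕ→ℚ (n + 1))
  i₂ = inv (ℕ→ℚ (ñ + 1))
  Iₘ X Y : ℕ → ℚ
  Iₘ b = I w n (suc m * suc h) (k ℤ.+ + b ℤ.* + suc h)
  X b = bernBar (n + 1) ((x +ℚ ℕ→ℚ b) *ℚ t)
  Y b = bernBar (ñ + 1) ((x +ℚ ℕ→ℚ b) *ℚ t)
  ΣI = Σ< (suc m) Iₘ

  power : ℕ→ℚ (suc m * suc h) ^ℚ w ≡ s ^ℚ w *ℚ Hʷ
  power = trans (cong (_^ℚ w) (ℕ→ℚ-homo-* (suc m) (suc h))) (^ℚ-distribʳ-* s H w)

  distribution₁ : s ^ℚ w *ℚ Σ< (suc m) X ≡ s ^ℚ ñ *ℚ bernBar (n + 1) x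
  distribution₁ = trans (cong (λ e → s ^ℚ e *ℚ Σ< (suc m) X) (sym (ℕP.m∸n+n≡m n≤w))) (bernBar-distribution-scaled m ñ n x)

  distribution₂ : s ^ℚ w *ℚ Σ< (suc m) Y ≡ s ^ℚ n *ℚ bernBar (ñ + 1) x
  distribution₂ = trans (cong (λ e → s ^ℚ e *ℚ Σ< (suc m) Y) (sym (ℕP.m+[n∸m]≡n n≤w))) (bernBar-distribution-scaled m n ñ x)

hecke-E : ∀ {w n m} → n ≤ w → Prime m →
    ((h : ℕ) → 0 < h → (k : ℤ) →
      T m (E w n) h k ≡
        I w n h (+ m ℤ.* k)
        ℚ.+ Σℚ (map (λ b → I w n (m * h) (k ℤ.+ + b ℤ.* + h)) (upTo m))
        ℚ.- inv (ℕ→ℚ (n + 1))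
            ℚ.* (bernBar (n + 1) (ℤ→ℚ (+ m ℤ.* k) ℚ.* inv (ℕ→ℚ h))
                 ℚ.+ ℕ→ℚ m ^ℚ tilde w n ℚ.* bernBar (n + 1) (ℤ→ℚ k ℚ.* inv (ℕ→ℚ h)))
            ℚ.* (ℕ→ℚ h ^ℚ w)
        ℚ.- inv (ℕ→ℚ (tilde w n + 1))
            ℚ.* (bernBar (tilde w n + 1) (ℤ→ℚ (+ m ℤ.* k) ℚ.* inv (ℕ→ℚ h))
                 ℚ.+ ℕ→ℚ m ^ℚ n ℚ.* bernBar (tilde w n + 1) (ℤ→ℚ k ℚ.* inv (ℕ→ℚ h)))
            ℚ.* (ℕ→ℚ h ^ℚ w)
        ℚ.+ (ℚ.1ℚ ℚ.+ ℕ→ℚ m ^ℚ (w + 1)) ℚ.* C w n ℚ.* (ℕ→ℚ h ^ℚ w))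
hecke-E {m = zero} n≤w pr = ⊥-elim (¬prime[0] pr)
hecke-E {w} {n} {suc m} n≤w pr (suc h) _ k = begin
  T (suc m) (E w n) (suc h) k
    ≡⟨ T-prime pr (E w n) (suc h) k ⟩
  E w n (suc h) (+ suc m ℤ.* k) +ℚ Σ< (suc m) (λ b → E w n (suc m * suc h) (k ℤ.+ + b ℤ.* + suc h))
    ≡⟨ cong (E w n (suc h) (+ suc m ℤ.* k) +ℚ_) (Σ<-E-translates w n m h k n≤w) ⟩
  _ ≡⟨ solve 13 (λ I₀ ΣI i₁ i₂ a₁ a₂ b₁ b₂ sñ sn sw c H →
         I₀ :- i₁ :* a₁ :* H :- i₂ :* a₂ :* H :+ c :* H :+ (ΣI :- i₁ :* (sñ :* b₁) :* H :- i₂ :* (sn :* b₂) :* H :+ sw :* c :* H)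
         := I₀ :+ ΣI :- i₁ :* (a₁ :+ sñ :* b₁) :* H :- i₂ :* (a₂ :+ sn :* b₂) :* H :+ (con 1ℚ :+ sw) :* c :* H)
       refl (I w n (suc h) (+ suc m ℤ.* k)) (Σ< (suc m) (λ b → I w n (suc m * suc h) (k ℤ.+ + b ℤ.* + suc h)))
       (inv (ℕ→ℚ (n + 1))) (inv (ℕ→ℚ (tilde w n + 1)))
       (bernBar (n + 1) (ℤ→ℚ (+ suc m ℤ.* k) *ℚ inv (ℕ→ℚ (suc h)))) (bernBar (tilde w n + 1) (ℤ→ℚ (+ suc m ℤ.* k) *ℚ inv (ℕ→ℚ (suc h))))
       (bernBar (n + 1) (ℤ→ℚ k *ℚ inv (ℕ→ℚ (suc h)))) (bernBar (tilde w n + 1) (ℤ→ℚ k *ℚ inv (ℕ→ℚ (suc h))))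
       (ℕ→ℚ (suc m) ^ℚ tilde w n) (ℕ→ℚ (suc m) ^ℚ n) (ℕ→ℚ (suc m) ^ℚ (w + 1)) (C w n) (ℕ→ℚ (suc h) ^ℚ w) ⟩
  _ ∎

-- By evaluation: ad - bc = 1 is incompatible with bd/(ac) < 0, so the index set of I(1,0) is empty.
I[1,0]≡0 : ∀ w n → I w n 1 (+ 0) ≡ 0ℚ
I[1,0]≡0 w n = refl

hecke-E-at-1-0 : ∀ {w n m} → n ≤ w → Prime m →
    T m (E w n) 1 (+ 0) ≡
        Σℚ (map (λ b → I w n m (+ b)) (upTo m))
        ℚ.- inv (ℕ→ℚ (n + 1)) ℚ.* bernoulli (n + 1) ℚ.* (ℚ.1ℚ ℚ.+ ℕ→ℚ m ^ℚ tilde w n)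
        ℚ.- inv (ℕ→ℚ (tilde w n + 1)) ℚ.* bernoulli (tilde w n + 1) ℚ.* (ℚ.1ℚ ℚ.+ ℕ→ℚ m ^ℚ n)
        ℚ.+ (ℚ.1ℚ ℚ.+ ℕ→ℚ m ^ℚ (w + 1)) ℚ.* C w n
hecke-E-at-1-0 {w} {n} {m} n≤w pr = trans (hecke-E n≤w pr 1 (ℕ.s≤s ℕ.z≤n) (+ 0))
  (specialise (trans (cong (I w n 1) m*0≡0) (I[1,0]≡0 w n))
              (cong Σℚ (ListP.map-cong (λ b → cong₂ (I w n) (ℕP.*-identityʳ m) (trans (ℤP.+-identityˡ _) (ℤP.*-identityʳ (+ b)))) (upTo m)))
              (trans (cong (λ z → bernBar (n + 1) (ℤ→ℚ z *ℚ inv (ℕ→ℚ 1))) m*0≡0) (bernBar-at-0 (n + 1)))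
              (bernBar-at-0 (n + 1))
              (trans (cong (λ z → bernBar (ñ + 1) (ℤ→ℚ z *ℚ inv (ℕ→ℚ 1))) m*0≡0) (bernBar-at-0 (ñ + 1)))
              (bernBar-at-0 (ñ + 1))
              (1^ℚ≡1 w))
  where
  ñ = tilde w n
  m*0≡0 : + m ℤ.* + 0 ≡ + 0
  m*0≡0 = ℤP.*-zeroʳ (+ m)

  rhs : ℚ → ℚ → ℚ → ℚ → ℚ → ℚ → ℚ → ℚ
  rhs I₀ ΣI a₁ b₁ a₂ b₂ hʷ = I₀ +ℚ ΣI
    -ℚ inv (ℕ→ℚ (n + 1)) *ℚ (a₁ +ℚ ℕ→ℚ m ^ℚ ñ *ℚ b₁) *ℚ hʷ
    -ℚ inv (ℕ→ℚ (ñ + 1)) *ℚ (a₂ +ℚ ℕ→ℚ m ^ℚ n *ℚ b₂) *ℚ hʷ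
    +ℚ (1ℚ +ℚ ℕ→ℚ m ^ℚ (w + 1)) *ℚ C w n *ℚ hʷ

  specialise : ∀ {I₀ ΣI a₁ b₁ a₂ b₂ hʷ} → I₀ ≡ 0ℚ → ΣI ≡ Σℚ (map (λ b → I w n m (+ b)) (upTo m)) →
    a₁ ≡ bernoulli (n + 1) → b₁ ≡ bernoulli (n + 1) → a₂ ≡ bernoulli (ñ + 1) → b₂ ≡ bernoulli (ñ + 1) → hʷ ≡ 1ℚ →
    rhs I₀ ΣI a₁ b₁ a₂ b₂ hʷ ≡
      Σℚ (map (λ b → I w n m (+ b)) (upTo m))
      -ℚ inv (ℕ→ℚ (n + 1)) *ℚ bernoulli (n + 1) *ℚ (1ℚ +ℚ ℕ→ℚ m ^ℚ ñ)
      -ℚ inv (ℕ→ℚ (ñ + 1)) *ℚ bernoulli (ñ + 1) *ℚ (1ℚ +ℚ ℕ→ℚ m ^ℚ n)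
      +ℚ (1ℚ +ℚ ℕ→ℚ m ^ℚ (w + 1)) *ℚ C w n
  specialise refl refl refl refl refl refl refl =
    solve 8 (λ ΣI i₁ i₂ B₁ B₂ sñ sn c →
      con 0ℚ :+ ΣI :- i₁ :* (B₁ :+ sñ :* B₁) :* con 1ℚ :- i₂ :* (B₂ :+ sn :* B₂) :* con 1ℚ :+ c :* con 1ℚ
      := ΣI :- i₁ :* B₁ :* (con 1ℚ :+ sñ) :- i₂ :* B₂ :* (con 1ℚ :+ sn) :+ c)
      refl (Σℚ (map (λ b → I w n m (+ b)) (upTo m))) (inv (ℕ→ℚ (n + 1))) (inv (ℕ→ℚ (ñ + 1)))
      (bernoulli (n + 1)) (bernoulli (ñ + 1)) (ℕ→ℚ m ^ℚ ñ) (ℕ→ℚ m ^ℚ n) ((1ℚ +ℚ ℕ→ℚ m ^ℚ (w + 1)) *ℚ C w n)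

lemma7p1 : (w n m : ℕ) → 2 ≤ w → 2 ∣ w → ¬ (2 ∣ n) → 0 < n → n < w → Prime m →
    ((h : ℕ) → 0 < h → (k : ℤ) →
      T m (E w n) h k ≡
        I w n h (+ m ℤ.* k)
        ℚ.+ Σℚ (map (λ b → I w n (m * h) (k ℤ.+ + b ℤ.* + h)) (upTo m))
        ℚ.- inv (ℕ→ℚ (n + 1))
            ℚ.* (bernBar (n + 1) (ℤ→ℚ (+ m ℤ.* k) ℚ.* inv (ℕ→ℚ h))
                 ℚ.+ ℕ→ℚ m ^ℚ tilde w n ℚ.* bernBar (n + 1) (ℤ→ℚ k ℚ.* inv (ℕ→ℚ h)))
            ℚ.* (ℕ→ℚ h ^ℚ w)
        ℚ.- inv (ℕ→ℚ (tilde w n + 1))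
            ℚ.* (bernBar (tilde w n + 1) (ℤ→ℚ (+ m ℤ.* k) ℚ.* inv (ℕ→ℚ h))
                 ℚ.+ ℕ→ℚ m ^ℚ n ℚ.* bernBar (tilde w n + 1) (ℤ→ℚ k ℚ.* inv (ℕ→ℚ h)))
            ℚ.* (ℕ→ℚ h ^ℚ w)
        ℚ.+ (ℚ.1ℚ ℚ.+ ℕ→ℚ m ^ℚ (w + 1)) ℚ.* C w n ℚ.* (ℕ→ℚ h ^ℚ w))
    × (T m (E w n) 1 (+ 0) ≡
        Σℚ (map (λ b → I w n m (+ b)) (upTo m))
        ℚ.- inv (ℕ→ℚ (n + 1)) ℚ.* bernoulli (n + 1) ℚ.* (ℚ.1ℚ ℚ.+ ℕ→ℚ m ^ℚ tilde w n)
        ℚ.- inv (ℕ→ℚ (tilde w n + 1)) ℚ.* bernoulli (tilde w n + 1) ℚ.* (ℚ.1ℚ ℚ.+ ℕ→ℚ m ^ℚ n)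
        ℚ.+ (ℚ.1ℚ ℚ.+ ℕ→ℚ m ^ℚ (w + 1)) ℚ.* C w n)
lemma7p1 w n m _ _ _ _ n<w pr = hecke-E (ℕP.<⇒≤ n<w) pr , hecke-E-at-1-0 (ℕP.<⇒≤ n<w) pr
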